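{- Let $a,b$ be non-negative integers and $G=T(a,b)$, with distance matrix $D(G)$. Then $$\det(D(G)-\lambda I)=(-\lambda-2)^{a+b-2}\,p_{a,b}(\lambda),$$ where $p_{a,b}(\lambda)=16 + 8a + 8b + 40\lambda + 36a\lambda + 36b\lambda + 8ab\lambda + 28\lambda^2 + 44 a\lambda^2 + 44b\lambda^2 + 24 ab\lambda^2 + 2 \lambda^3 + 18 a\lambda^3 + 18 b\lambda^3 + 12 ab\lambda^3 - 4 \lambda^4 + 2 a\lambda^4 + 2 b\lambda^4 - \lambda^5.$
   Context: For non-negative integers $a,b$, $T(a,b)$ is the graph obtained from the stars $K_{1,a}$ and $K_{1,b}$ by joining both of their centers to one new common vertex; it has $a+b+3$ vertices. The distance matrix $D(G)$ of a connected graph $G$ is the matrix of pairwise graph distances between its vertices, and $I$ is the identity matrix. -}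

module Defs where

open import Data.Nat using (ℕ; zero; suc; _≤_; _<_)
import Data.Nat as ℕ
open import Data.Fin using (Fin; zero; suc; toℕ; punchIn)
open import Data.Integer using (ℤ; +_; -_; _+_; _-_; _*_; _^_)
open import Data.Sum using (_⊎_)
open import Data.Product using (_×_)
open import Relation.Nullary using (does)
open import Data.Fin using (_≟_)
open import Data.Bool using (if_then_else_)

Matrix : ℕ → Set
Matrix n = Fin n → Fin n → ℤ

sumFin : ∀ {n} → (Fin n → ℤ) → ℤ
sumFin {zero}  f = + 0
sumFin {suc n} f = f zero + sumFin (λ i → f (suc i))

minor : ∀ {n} → Matrix (suc n) → Fin (suc n) → Matrix n
minor M j r c = M (suc r) (punchIn j c)

det : ∀ {n} → Matrix n → ℤ
det {zero}  M = + 1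
det {suc n} M = sumFin (λ j → ((- + 1) ^ toℕ j) * (M zero j * det (minor M j)))

data Walk {n : ℕ} (Adj : Fin n → Fin n → Set) : Fin n → Fin n → ℕ → Set where
  here : ∀ {u} → Walk Adj u u 0
  step : ∀ {u v w k} → Adj u v → Walk Adj v w k → Walk Adj u w (suc k)

IsDist : ∀ {n} → (Fin n → Fin n → Set) → Fin n → Fin n → ℕ → Set
IsDist Adj u v k = Walk Adj u v k × (∀ m → Walk Adj u v m → k ≤ m)

IsDistanceMatrix : ∀ {n} → (Fin n → Fin n → Set) → (Fin n → Fin n → ℕ) → Set
IsDistanceMatrix Adj D = ∀ i j → IsDist Adj i j (D i j)

-- The graph T(a,b) on vertex set Fin (a + b + 3):
-- vertex 0 = common new vertex, 1 = center of K_{1,a}, 2 = center of K_{1,b},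
-- vertices 3 .. a+2 = leaves of the first star, a+3 .. a+b+2 = leaves of the second.
data TEdge (a b : ℕ) : ℕ → ℕ → Set where
  e01 : TEdge a b 0 1
  e02 : TEdge a b 0 2
  e1  : ∀ k → 3 ≤ k → k < 3 ℕ.+ a → TEdge a b 1 k
  e2  : ∀ k → 3 ℕ.+ a ≤ k → k < 3 ℕ.+ a ℕ.+ b → TEdge a b 2 k

TAdj : (a b : ℕ) → Fin (a ℕ.+ b ℕ.+ 3) → Fin (a ℕ.+ b ℕ.+ 3) → Set
TAdj a b i j = TEdge a b (toℕ i) (toℕ j) ⊎ TEdge a b (toℕ j) (toℕ i)

δ : ∀ {n} → Fin n → Fin n → ℤ
δ i j = if does (i ≟ j) then + 1 else + 0

shiftedDist : ∀ {n} → (Fin n → Fin n → ℕ) → ℤ → Matrix n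
shiftedDist D x i j = + D i j - x * δ i j

p : ℕ → ℕ → ℤ → ℤ
p a' b' x =
  + 16 + + 8 * a + + 8 * b
  + + 40 * x + + 36 * a * x + + 36 * b * x + + 8 * a * b * x
  + + 28 * x ^ 2 + + 44 * a * x ^ 2 + + 44 * b * x ^ 2 + + 24 * a * b * x ^ 2
  + + 2 * x ^ 3 + + 18 * a * x ^ 3 + + 18 * b * x ^ 3 + + 12 * a * b * x ^ 3
  - + 4 * x ^ 4 + + 2 * a * x ^ 4 + + 2 * b * x ^ 4
  - x ^ 5
  where
    a = + a'
    b = + b'

{-# OPTIONS --safe #-}
-- Sort the vertices of T(a,b) into five classes: the hub, the two centres and the
-- leaves of each star.  The distance between two distinct vertices depends only on their classes,
-- and the row of D - xI belonging to a leaf is the row of distances from a further leaf of its star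
-- plus ζ = -x-2 on the diagonal.  Splitting that diagonal term off by linearity, and subtracting the
-- rows of two leaves of the same star, gives first-order recurrences in a and in b with coefficients
-- powers of ζ; their solutions reduce everything to four determinants of size at most 5, which the
-- ring solver expands.  The result is det (D - xI) = ζ^(a∸1) ζ^(b∸1) q and p = ζ^(1∸a) ζ^(1∸b) q for
-- one polynomial q, and the truncated exponents of the statement balance exactly.
module Submission where

open import Defs
open import Data.Bool using (Bool; true; false; T; if_then_else_; _∧_)
open import Data.Bool.Properties using (T-∧)
open import Data.Empty using (⊥-elim)
open import Data.Fin as Fin using (Fin; zero; suc; toℕ; punchIn; inject₁)
open import Data.Fin.Properties
  using (punchIn-injective; punchInᵢ≢i; toℕ-inject₁; suc-injective; toℕ-injective; toℕ-fromℕ<; toℕ-fromℕ; toℕ<n)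
open import Data.Integer using (ℤ; +_; -_; _+_; _-_; _*_; _^_; -[1+_]; -1ℤ)
import Data.Integer.Properties as ℤ
open import Data.Integer.Solver using (module +-*-Solver)
open +-*-Solver using (Polynomial; con; var; _:+_; _:*_; :-_; _:-_; _:^_; _:=_; ⟦_⟧; solve)
open import Data.Integer.Tactic.RingSolver using (solve-∀)
open import Data.Nat as ℕ using (ℕ; zero; suc; z≤n; s≤s; _∸_; _⊓_)
import Data.Nat.Properties as ℕ
open import Data.Product using (_,_; _×_; proj₁; proj₂)
open import Data.Sum using (inj₁; inj₂)
open import Data.Vec using (_∷_; [])
open import Function using (_∘_)
open import Function.Bundles using (Equivalence)
open import Relation.Nullary using (does; yes; no)
open import Relation.Nullary.Decidable using (dec-true; dec-false)
open import Relation.Binary.PropositionalEquality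

sumFin-cong : ∀ {n} {f g : Fin n → ℤ} → (∀ i → f i ≡ g i) → sumFin f ≡ sumFin g
sumFin-cong {zero}  f≗g = refl
sumFin-cong {suc n} f≗g = cong₂ _+_ (f≗g zero) (sumFin-cong (f≗g ∘ suc))

sumFin-zero : ∀ {n} (f : Fin n → ℤ) → (∀ i → f i ≡ + 0) → sumFin f ≡ + 0
sumFin-zero {zero}  f f≗0 = refl
sumFin-zero {suc n} f f≗0 = cong₂ _+_ (f≗0 zero) (sumFin-zero (f ∘ suc) (f≗0 ∘ suc))

sumFin-distrib-+ : ∀ {n} (f g : Fin n → ℤ) → sumFin (λ i → f i + g i) ≡ sumFin f + sumFin g
sumFin-distrib-+ {zero}  f g = refl
sumFin-distrib-+ {suc n} f g = begin
  f zero + g zero + sumFin (λ i → f (suc i) + g (suc i))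
    ≡⟨ cong (_+_ (f zero + g zero)) (sumFin-distrib-+ (f ∘ suc) (g ∘ suc)) ⟩
  f zero + g zero + (sumFin (f ∘ suc) + sumFin (g ∘ suc))
    ≡⟨ interchange (f zero) (g zero) (sumFin (f ∘ suc)) (sumFin (g ∘ suc)) ⟩
  f zero + sumFin (f ∘ suc) + (g zero + sumFin (g ∘ suc)) ∎
  where
  open ≡-Reasoning
  interchange : ∀ a b c d → a + b + (c + d) ≡ a + c + (b + d)
  interchange = solve-∀

sumFin-*ˡ : ∀ {n} (k : ℤ) (f : Fin n → ℤ) → sumFin (λ i → k * f i) ≡ k * sumFin f
sumFin-*ˡ {zero}  k f = sym (ℤ.*-zeroʳ k)
sumFin-*ˡ {suc n} k f =
  trans (cong (_+_ (k * f zero)) (sumFin-*ˡ k (f ∘ suc))) (distrib k (f zero) (sumFin (f ∘ suc)))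
  where
  distrib : ∀ k a b → k * a + k * b ≡ k * (a + b)
  distrib = solve-∀

sumFin-single : ∀ {n} (f : Fin n → ℤ) (k : Fin n) → (∀ j → j ≢ k → f j ≡ + 0) → sumFin f ≡ f k
sumFin-single {suc n} f zero f≗0 =
  trans (cong (_+_ (f zero)) (sumFin-zero (f ∘ suc) (λ i → f≗0 (suc i) λ ()))) (ℤ.+-identityʳ (f zero))
sumFin-single {suc n} f (suc k) f≗0 =
  trans (cong₂ _+_ (f≗0 zero λ ()) (sumFin-single (f ∘ suc) k λ j j≢k → f≗0 (suc j) (j≢k ∘ suc-injective)))
        (ℤ.+-identityˡ (f (suc k)))

sumFin-punchIn : ∀ {n} (k : Fin (suc n)) (f : Fin (suc n) → ℤ) →
                 sumFin f ≡ f k + sumFin (f ∘ punchIn k)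
sumFin-punchIn         zero    f = refl
sumFin-punchIn {suc n} (suc k) f =
  trans (cong (_+_ (f zero)) (sumFin-punchIn k (f ∘ suc)))
        (left-comm (f zero) (f (suc k)) (sumFin (f ∘ suc ∘ punchIn k)))
  where
  left-comm : ∀ a b c → a + (b + c) ≡ b + (a + c)
  left-comm = solve-∀

≡ᵇ-refl : ∀ n → (n ℕ.≡ᵇ n) ≡ true
≡ᵇ-refl n = dec-true (n ℕ.≟ n) refl

≡ᵇ-≢ : ∀ {m n} → m ≢ n → (m ℕ.≡ᵇ n) ≡ false
≡ᵇ-≢ {m} {n} = dec-false (m ℕ.≟ n)

cofactorTerm : ∀ {n} → Matrix (suc n) → Fin (suc n) → ℤ
cofactorTerm M j = -1ℤ ^ toℕ j * (M zero j * det (minor M j))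

cofactorTerm-zero-entry : ∀ {n} (M : Matrix (suc n)) j → M zero j ≡ + 0 → cofactorTerm M j ≡ + 0
cofactorTerm-zero-entry M j M₀ⱼ≡0 =
  trans (cong (λ a → -1ℤ ^ toℕ j * (a * det (minor M j))) M₀ⱼ≡0) (ℤ.*-zeroʳ (-1ℤ ^ toℕ j))

cofactorTerm-zero-minor : ∀ {n} (M : Matrix (suc n)) j → det (minor M j) ≡ + 0 → cofactorTerm M j ≡ + 0
cofactorTerm-zero-minor M j det≡0 =
  trans (cong (λ d → -1ℤ ^ toℕ j * (M zero j * d)) det≡0)
        (trans (cong (-1ℤ ^ toℕ j *_) (ℤ.*-zeroʳ (M zero j))) (ℤ.*-zeroʳ (-1ℤ ^ toℕ j)))

det-cong : ∀ {n} {M N : Matrix n} → (∀ i j → M i j ≡ N i j) → det M ≡ det N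
det-cong {zero}  M≗N = refl
det-cong {suc n} M≗N = sumFin-cong λ j →
  cong₂ (λ u v → -1ℤ ^ toℕ j * (u * v)) (M≗N zero j) (det-cong λ r c → M≗N (suc r) (punchIn j c))

det-linear-termwise : ∀ {n} (A B C : Matrix (suc n)) (t : ℤ) →
                      (∀ j → cofactorTerm A j ≡ cofactorTerm B j + t * cofactorTerm C j) →
                      det A ≡ det B + t * det C
det-linear-termwise A B C t terms = begin
  sumFin (cofactorTerm A)
    ≡⟨ sumFin-cong terms ⟩
  sumFin (λ j → cofactorTerm B j + t * cofactorTerm C j)
    ≡⟨ sumFin-distrib-+ (cofactorTerm B) (λ j → t * cofactorTerm C j) ⟩
  det B + sumFin (λ j → t * cofactorTerm C j)
    ≡⟨ cong (_+_ (det B)) (sumFin-*ˡ t (cofactorTerm C)) ⟩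
  det B + t * det C ∎
  where open ≡-Reasoning

det-linear-row : ∀ {n} (i : Fin n) (A B C : Matrix n) (t : ℤ) →
                 (∀ r → r ≢ i → ∀ c → A r c ≡ B r c) →
                 (∀ r → r ≢ i → ∀ c → A r c ≡ C r c) →
                 (∀ c → A i c ≡ B i c + t * C i c) →
                 det A ≡ det B + t * det C
det-linear-row zero A B C t A≗B A≗C Aᵢ = det-linear-termwise A B C t λ j →
  split-entry (-1ℤ ^ toℕ j) (B zero j) (C zero j) (det (minor B j)) (det (minor C j)) (Aᵢ j)
              (det-cong λ r c → A≗B (suc r) (λ ()) (punchIn j c))
              (det-cong λ r c → A≗C (suc r) (λ ()) (punchIn j c))
  where
  split-entry : ∀ s b c d′ d″ {a d} → a ≡ b + t * c → d ≡ d′ → d ≡ d″ →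
                s * (a * d) ≡ s * (b * d′) + t * (s * (c * d″))
  split-entry s b c d _ refl refl refl = distrib t s b c d
    where
    distrib : ∀ t s b c d → s * ((b + t * c) * d) ≡ s * (b * d) + t * (s * (c * d))
    distrib = solve-∀
det-linear-row (suc i) A B C t A≗B A≗C Aᵢ = det-linear-termwise A B C t λ j →
  split-minor (-1ℤ ^ toℕ j) (B zero j) (C zero j) (det (minor B j)) (det (minor C j))
              (A≗B zero (λ ()) j) (A≗C zero (λ ()) j)
    (det-linear-row i (minor A j) (minor B j) (minor C j) t
      (λ r r≢i c → A≗B (suc r) (r≢i ∘ suc-injective) (punchIn j c))
      (λ r r≢i c → A≗C (suc r) (r≢i ∘ suc-injective) (punchIn j c))
      (λ c → Aᵢ (punchIn j c)))
  where
  split-minor : ∀ s b c d′ d″ {a d} → a ≡ b → a ≡ c → d ≡ d′ + t * d″ →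
                s * (a * d) ≡ s * (b * d′) + t * (s * (c * d″))
  split-minor s b _ d′ d″ refl refl refl = distrib t s b d′ d″
    where
    distrib : ∀ t s a d′ d″ → s * (a * (d′ + t * d″)) ≡ s * (a * d′) + t * (s * (a * d″))
    distrib = solve-∀

det-zero-row : ∀ {n} (i : Fin n) (A : Matrix n) → (∀ c → A i c ≡ + 0) → det A ≡ + 0
det-zero-row i A Aᵢ≗0 =
  trans (det-linear-row i A A A -1ℤ (λ _ _ _ → refl) (λ _ _ _ → refl) λ c → sym (cancel (Aᵢ≗0 c)))
        (self-cancel (det A))
  where
  self-cancel : ∀ d → d + -1ℤ * d ≡ + 0
  self-cancel = solve-∀
  cancel : ∀ {a} → a ≡ + 0 → a + -1ℤ * a ≡ a
  cancel refl = refl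

unitVec : ∀ {n} → ℤ → Fin n → Fin n → ℤ
unitVec t k c = if toℕ c ℕ.≡ᵇ toℕ k then t else + 0

unitVec-diag : ∀ {n} t (k : Fin n) → unitVec t k k ≡ t
unitVec-diag t k rewrite ≡ᵇ-refl (toℕ k) = refl

unitVec-off : ∀ {n} t {k j : Fin n} → j ≢ k → unitVec t k j ≡ + 0
unitVec-off t j≢k rewrite ≡ᵇ-≢ (j≢k ∘ toℕ-injective) = refl

unitVec-punchIn : ∀ {n} t (p : Fin (suc n)) (k c : Fin n) →
                  unitVec t (punchIn p k) (punchIn p c) ≡ unitVec t k c
unitVec-punchIn t p k c with c Fin.≟ k
... | yes refl = trans (unitVec-diag t (punchIn p c)) (sym (unitVec-diag t c))
... | no c≢k   = trans (unitVec-off t (c≢k ∘ punchIn-injective p c k)) (sym (unitVec-off t c≢k))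

deleteRowCol : ∀ {n} → Matrix (suc n) → Fin (suc n) → Fin (suc n) → Matrix n
deleteRowCol M i k r c = M (punchIn i r) (punchIn k c)

-- The index of k in Fin n once the element punchIn k m of Fin (suc n) has been removed.
indexWithout : ∀ {n} → Fin (suc n) → Fin n → Fin n
indexWithout {suc n} zero    m       = zero
indexWithout {suc n} (suc k) zero    = k
indexWithout {suc n} (suc k) (suc m) = suc (indexWithout k m)

punchIn-indexWithout : ∀ {n} (k : Fin (suc n)) (m : Fin n) → punchIn (punchIn k m) (indexWithout k m) ≡ k
punchIn-indexWithout {suc n} zero    m       = refl
punchIn-indexWithout {suc n} (suc k) zero    = refl
punchIn-indexWithout {suc n} (suc k) (suc m) = cong suc (punchIn-indexWithout k m)

punchIn-indexWithout-comm : ∀ {n} (k : Fin (suc (suc n))) (m : Fin (suc n)) (c : Fin n) →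
                            punchIn (punchIn k m) (punchIn (indexWithout k m) c) ≡ punchIn k (punchIn m c)
punchIn-indexWithout-comm zero    m       c = refl
punchIn-indexWithout-comm (suc k) zero    c = refl
punchIn-indexWithout-comm {suc n} (suc k) (suc m) zero    = refl
punchIn-indexWithout-comm {suc n} (suc k) (suc m) (suc c) = cong suc (punchIn-indexWithout-comm k m c)

sign-indexWithout : ∀ {n} (k : Fin (suc n)) (m : Fin n) →
                    -1ℤ ^ toℕ (punchIn k m) * -1ℤ ^ toℕ (indexWithout k m) ≡ - (-1ℤ ^ toℕ k * -1ℤ ^ toℕ m)
sign-indexWithout {suc n} zero m = lemma (-1ℤ ^ toℕ m)
  where
  lemma : ∀ s → -1ℤ * s * + 1 ≡ - (+ 1 * s)
  lemma = solve-∀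
sign-indexWithout {suc n} (suc k) zero = lemma (-1ℤ ^ toℕ k)
  where
  lemma : ∀ s → + 1 * s ≡ - (-1ℤ * s * + 1)
  lemma = solve-∀
sign-indexWithout {suc n} (suc k) (suc m) =
  trans (lemma₁ (-1ℤ ^ toℕ (punchIn k m)) (-1ℤ ^ toℕ (indexWithout k m)))
        (trans (sign-indexWithout k m) (lemma₂ (-1ℤ ^ toℕ k) (-1ℤ ^ toℕ m)))
  where
  lemma₁ : ∀ a b → -1ℤ * a * (-1ℤ * b) ≡ a * b
  lemma₁ = solve-∀
  lemma₂ : ∀ a b → - (a * b) ≡ - (-1ℤ * a * (-1ℤ * b))
  lemma₂ = solve-∀

-1ℤ^n*-1ℤ^n≡1 : ∀ n → -1ℤ ^ n * -1ℤ ^ n ≡ + 1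
-1ℤ^n*-1ℤ^n≡1 zero    = refl
-1ℤ^n*-1ℤ^n≡1 (suc n) = trans (lemma (-1ℤ ^ n)) (-1ℤ^n*-1ℤ^n≡1 n)
  where
  lemma : ∀ s → -1ℤ * s * (-1ℤ * s) ≡ s * s
  lemma = solve-∀

det-unit-row : ∀ {n} (i k : Fin (suc n)) (M : Matrix (suc n)) (t : ℤ) → (∀ c → M i c ≡ unitVec t k c) →
               det M ≡ -1ℤ ^ toℕ i * (-1ℤ ^ toℕ k * (t * det (deleteRowCol M i k)))
det-unit-row zero k M t Mᵢ = begin
  det M             ≡⟨ sumFin-single (cofactorTerm M) k (λ j j≢k →
                         cofactorTerm-zero-entry M j (trans (Mᵢ j) (unitVec-off t j≢k))) ⟩
  cofactorTerm M k  ≡⟨ cong (λ a → -1ℤ ^ toℕ k * (a * det (minor M k))) (trans (Mᵢ k) (unitVec-diag t k)) ⟩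
  -1ℤ ^ toℕ k * (t * det (minor M k))  ≡⟨ sym (ℤ.*-identityˡ _) ⟩
  + 1 * (-1ℤ ^ toℕ k * (t * det (minor M k))) ∎
  where open ≡-Reasoning
det-unit-row {suc n} (suc i) k M t Mᵢ = begin
  det M
    ≡⟨ sumFin-punchIn k (cofactorTerm M) ⟩
  cofactorTerm M k + sumFin (cofactorTerm M ∘ punchIn k)
    ≡⟨ cong₂ _+_ vanishing-term (sumFin-cong term) ⟩
  + 0 + sumFin (λ m → σ * cofactorTerm N m)
    ≡⟨ trans (ℤ.+-identityˡ _) (sumFin-*ˡ σ (cofactorTerm N)) ⟩
  σ * det N
    ≡⟨ reassoc (-1ℤ ^ toℕ i) (-1ℤ ^ toℕ k) t (det N) ⟩
  -1ℤ ^ toℕ (suc i) * (-1ℤ ^ toℕ k * (t * det N)) ∎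
  where
  open ≡-Reasoning
  N : Matrix (suc n)
  N = deleteRowCol M (suc i) k
  σ : ℤ
  σ = - (-1ℤ ^ toℕ i) * (-1ℤ ^ toℕ k * t)
  reassoc : ∀ s s′ t d → - s * (s′ * t) * d ≡ -1ℤ * s * (s′ * (t * d))
  reassoc = solve-∀
  vanishing-term : cofactorTerm M k ≡ + 0
  vanishing-term = cofactorTerm-zero-minor M k
    (det-zero-row i (minor M k) λ c → trans (Mᵢ (punchIn k c)) (unitVec-off t (punchInᵢ≢i k c)))
  term : ∀ m → cofactorTerm M (punchIn k m) ≡ σ * cofactorTerm N m
  term m = begin
    sⱼ * (a * det (minor M j))
      ≡⟨ cong (λ d → sⱼ * (a * d)) (det-unit-row i q (minor M j) t row-i) ⟩
    sⱼ * (a * (sᵢ * (s′ * (t * det (deleteRowCol (minor M j) i q)))))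
      ≡⟨ cong (λ d → sⱼ * (a * (sᵢ * (s′ * (t * d)))))
              (det-cong λ r c → cong (M (suc (punchIn i r))) (punchIn-indexWithout-comm k m c)) ⟩
    sⱼ * (a * (sᵢ * (s′ * (t * D))))
      ≡⟨ regroup sⱼ a sᵢ s′ t D ⟩
    (sⱼ * s′) * (sᵢ * t * a * D)
      ≡⟨ cong (_* (sᵢ * t * a * D)) (sign-indexWithout k m) ⟩
    - (sₖ * sₘ) * (sᵢ * t * a * D)
      ≡⟨ regroup′ sₖ sₘ sᵢ t a D ⟩
    σ * (sₘ * (a * D)) ∎
    where
    j : Fin (suc (suc n))
    j = punchIn k m
    q : Fin (suc n)
    q = indexWithout k m
    sᵢ sⱼ sₖ sₘ s′ a D : ℤ
    sᵢ = -1ℤ ^ toℕ i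
    sⱼ = -1ℤ ^ toℕ j
    sₖ = -1ℤ ^ toℕ k
    sₘ = -1ℤ ^ toℕ m
    s′ = -1ℤ ^ toℕ q
    a = M zero j
    D = det (minor N m)
    row-i : ∀ c → minor M j i c ≡ unitVec t q c
    row-i c = begin
      M (suc i) (punchIn j c)            ≡⟨ Mᵢ (punchIn j c) ⟩
      unitVec t k (punchIn j c)          ≡⟨ cong (λ k′ → unitVec t k′ (punchIn j c)) (sym (punchIn-indexWithout k m)) ⟩
      unitVec t (punchIn j q) (punchIn j c) ≡⟨ unitVec-punchIn t j q c ⟩
      unitVec t q c ∎
    regroup : ∀ sⱼ a sᵢ s′ t D → sⱼ * (a * (sᵢ * (s′ * (t * D)))) ≡ (sⱼ * s′) * (sᵢ * t * a * D)
    regroup = solve-∀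
    regroup′ : ∀ sₖ sₘ sᵢ t a D → - (sₖ * sₘ) * (sᵢ * t * a * D) ≡ - sᵢ * (sₖ * t) * (sₘ * (a * D))
    regroup′ = solve-∀

setRow : ∀ {n} → Matrix n → Fin n → (Fin n → ℤ) → Matrix n
setRow M i v r c = if does (r Fin.≟ i) then v c else M r c

setRow-same : ∀ {n} (M : Matrix n) i v c → setRow M i v i c ≡ v c
setRow-same M i v c rewrite dec-true (i Fin.≟ i) refl = refl

setRow-other : ∀ {n} (M : Matrix n) {i} v {r} c → r ≢ i → setRow M i v r c ≡ M r c
setRow-other M {i} v {r} c r≢i rewrite dec-false (r Fin.≟ i) r≢i = refl

setRow-setRow : ∀ {n} (M : Matrix n) i v w r c → setRow (setRow M i w) i v r c ≡ setRow M i v r c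
setRow-setRow M i v w r c with does (r Fin.≟ i)
... | true  = refl
... | false = refl

det-row-sum : ∀ {n m} (i : Fin n) (A : Matrix n) (G : Fin m → Fin n → ℤ) →
              (∀ c → A i c ≡ sumFin (λ s → G s c)) →
              det A ≡ sumFin (λ s → det (setRow A i (G s)))
det-row-sum {m = zero}  i A G Aᵢ = det-zero-row i A Aᵢ
det-row-sum {m = suc m} i A G Aᵢ = begin
  det A
    ≡⟨ det-linear-row i A (setRow A i (G zero)) A′ (+ 1)
         (λ r r≢i c → sym (setRow-other A (G zero) c r≢i))
         (λ r r≢i c → sym (setRow-other A rest c r≢i))
         (λ c → trans (Aᵢ c) (sym (trans (cong₂ (λ u v → u + + 1 * v) (setRow-same A i (G zero) c)
                                                                      (setRow-same A i rest c))
                                             (cong (_+_ (G zero c)) (ℤ.*-identityˡ (rest c)))))) ⟩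
  det (setRow A i (G zero)) + + 1 * det A′
    ≡⟨ cong (_+_ (det (setRow A i (G zero)))) (ℤ.*-identityˡ (det A′)) ⟩
  det (setRow A i (G zero)) + det A′
    ≡⟨ cong (_+_ (det (setRow A i (G zero))))
            (trans (det-row-sum i A′ (G ∘ suc) (setRow-same A i rest))
                   (sumFin-cong λ s → det-cong (setRow-setRow A i (G (suc s)) rest))) ⟩
  det (setRow A i (G zero)) + sumFin (λ s → det (setRow A i (G (suc s)))) ∎
  where
  open ≡-Reasoning
  rest : Fin _ → ℤ
  rest c = sumFin (λ s → G (suc s) c)
  A′ : Matrix _
  A′ = setRow A i rest

det-expand-row : ∀ {n} (i : Fin (suc n)) (M : Matrix (suc n)) →
                 det M ≡ sumFin (λ c → -1ℤ ^ toℕ i * (-1ℤ ^ toℕ c * (M i c * det (deleteRowCol M i c))))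
det-expand-row i M = trans (det-row-sum i M G Mᵢ) (sumFin-cong term)
  where
  G : Fin _ → Fin _ → ℤ
  G c = unitVec (M i c) c
  Mᵢ : ∀ c → M i c ≡ sumFin (λ s → G s c)
  Mᵢ c = sym (trans (sumFin-single (λ s → G s c) c (λ s s≢c → unitVec-off (M i s) (s≢c ∘ sym)))
                    (unitVec-diag (M i c) c))
  term : ∀ c → det (setRow M i (G c)) ≡ -1ℤ ^ toℕ i * (-1ℤ ^ toℕ c * (M i c * det (deleteRowCol M i c)))
  term c = trans (det-unit-row i c (setRow M i (G c)) (M i c) (setRow-same M i (G c)))
                 (cong (λ d → -1ℤ ^ toℕ i * (-1ℤ ^ toℕ c * (M i c * d)))
                       (det-cong λ r c′ → setRow-other M (G c) (punchIn c c′) (punchInᵢ≢i i r)))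

-- Expanding along rows 0 and 1 gives the same sum with opposite signs.
det-equal-rows₀₁ : ∀ {n} (M : Matrix (suc (suc n))) → (∀ c → M zero c ≡ M (suc zero) c) → det M ≡ + 0
det-equal-rows₀₁ M M₀≗M₁ = self-negative-zero (det M) (begin
  det M
    ≡⟨ det-expand-row (suc zero) M ⟩
  sumFin (λ c → -1ℤ * (-1ℤ ^ toℕ c * (M (suc zero) c * det (deleteRowCol M (suc zero) c))))
    ≡⟨ sumFin-cong (λ c → cong₂ (λ a d → -1ℤ * (-1ℤ ^ toℕ c * (a * d))) (sym (M₀≗M₁ c))
                                (det-cong (deleted-row₁ c))) ⟩
  sumFin (λ c → -1ℤ * cofactorTerm M c)
    ≡⟨ sumFin-*ˡ -1ℤ (cofactorTerm M) ⟩
  -1ℤ * det M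
    ≡⟨ ℤ.-1*i≡-i (det M) ⟩
  - det M ∎)
  where
  open ≡-Reasoning
  deleted-row₁ : ∀ c r c′ → deleteRowCol M (suc zero) c r c′ ≡ minor M c r c′
  deleted-row₁ c zero    c′ = M₀≗M₁ (punchIn c c′)
  deleted-row₁ c (suc r) c′ = refl
  self-negative-zero : ∀ d → d ≡ - d → d ≡ + 0
  self-negative-zero (+ zero)  _  = refl
  self-negative-zero (+ suc _) ()
  self-negative-zero -[1+ _ ]  ()

det-equal-adjacent-rows : ∀ {n} (i : Fin n) (M : Matrix (suc n)) →
                          (∀ c → M (inject₁ i) c ≡ M (suc i) c) → det M ≡ + 0
det-equal-adjacent-rows {suc n} zero    M Mᵢ≗Mᵢ₊₁ = det-equal-rows₀₁ M Mᵢ≗Mᵢ₊₁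
det-equal-adjacent-rows {suc n} (suc i) M Mᵢ≗Mᵢ₊₁ = sumFin-zero (cofactorTerm M) λ j →
  cofactorTerm-zero-minor M j (det-equal-adjacent-rows i (minor M j) (Mᵢ≗Mᵢ₊₁ ∘ punchIn j))

det-diagonal-split : ∀ {n} (M M′ : Matrix (suc n)) (p : Fin (suc n)) (t : ℤ) →
                     (∀ r → r ≢ p → ∀ c → M r c ≡ M′ r c) →
                     (∀ c → M p c ≡ M′ p c + t * unitVec (+ 1) p c) →
                     det M ≡ det M′ + t * det (deleteRowCol M p p)
det-diagonal-split M M′ p t M≗M′ Mₚ =
  trans (det-linear-row p M M′ U t M≗M′ (λ r r≢p c → sym (setRow-other M eₚ c r≢p))
                        (λ c → trans (Mₚ c) (cong (λ u → M′ p c + t * u) (sym (setRow-same M p eₚ c)))))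
        (cong (λ d → det M′ + t * d) (begin
          det U
            ≡⟨ det-unit-row p p U (+ 1) (setRow-same M p eₚ) ⟩
          s * (s * (+ 1 * det (deleteRowCol U p p)))
            ≡⟨ cong (λ d → s * (s * (+ 1 * d)))
                    (det-cong λ r c → setRow-other M eₚ (punchIn p c) (punchInᵢ≢i p r)) ⟩
          s * (s * (+ 1 * det (deleteRowCol M p p)))
            ≡⟨ sign-squared s (det (deleteRowCol M p p)) (-1ℤ^n*-1ℤ^n≡1 (toℕ p)) ⟩
          det (deleteRowCol M p p) ∎))
  where
  open ≡-Reasoning
  eₚ : Fin _ → ℤ
  eₚ = unitVec (+ 1) p
  U : Matrix _
  U = setRow M p eₚ
  s : ℤ
  s = -1ℤ ^ toℕ p
  sign-squared : ∀ s d → s * s ≡ + 1 → s * (s * (+ 1 * d)) ≡ d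
  sign-squared s d s²≡1 = trans (regroup s d) (trans (cong (_* d) s²≡1) (ℤ.*-identityˡ d))
    where
    regroup : ∀ s d → s * (s * (+ 1 * d)) ≡ s * s * d
    regroup = solve-∀

det-adjacent-row-shift : ∀ {n} (M : Matrix (suc n)) (q : Fin n) (t : ℤ) →
                         (∀ c → M (suc q) c ≡ M (inject₁ q) c + t * unitVec (+ 1) (inject₁ q) c) →
                         det M ≡ - (t * det (deleteRowCol M (suc q) (inject₁ q)))
det-adjacent-row-shift M q t Mq₊₁ = begin
  det M
    ≡⟨ det-linear-row (suc q) M B C t (λ r r≢ c → sym (setRow-other M w c r≢))
                                       (λ r r≢ c → sym (setRow-other M v c r≢))
                      (λ c → trans (Mq₊₁ c) (cong₂ (λ u u′ → u + t * u′) (sym (setRow-same M (suc q) w c))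
                                                                        (sym (setRow-same M (suc q) v c)))) ⟩
  det B + t * det C
    ≡⟨ cong₂ (λ d d′ → d + t * d′)
             (det-equal-adjacent-rows q B λ c → trans (setRow-other M w c inject₁≢suc)
                                                      (sym (setRow-same M (suc q) w c)))
             (det-unit-row (suc q) (inject₁ q) C (+ 1) (setRow-same M (suc q) v)) ⟩
  + 0 + t * (-1ℤ * s * (s′ * (+ 1 * det (deleteRowCol C (suc q) (inject₁ q)))))
    ≡⟨ cong₂ (λ σ d → + 0 + t * (-1ℤ * s * (σ * (+ 1 * d))))
             (cong (-1ℤ ^_) (toℕ-inject₁ q))
             (det-cong λ r c → setRow-other M v (punchIn (inject₁ q) c) (punchInᵢ≢i (suc q) r)) ⟩
  + 0 + t * (-1ℤ * s * (s * (+ 1 * D)))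
    ≡⟨ regroup t s D ⟩
  - (t * (s * s * D))
    ≡⟨ cong (λ σ → - (t * (σ * D))) (-1ℤ^n*-1ℤ^n≡1 (toℕ q)) ⟩
  - (t * (+ 1 * D))
    ≡⟨ cong (λ d → - (t * d)) (ℤ.*-identityˡ D) ⟩
  - (t * D) ∎
  where
  open ≡-Reasoning
  v w : Fin _ → ℤ
  v = unitVec (+ 1) (inject₁ q)
  w = M (inject₁ q)
  B C : Matrix _
  B = setRow M (suc q) w
  C = setRow M (suc q) v
  s s′ D : ℤ
  s  = -1ℤ ^ toℕ q
  s′ = -1ℤ ^ toℕ (inject₁ q)
  D  = det (deleteRowCol M (suc q) (inject₁ q))
  inject₁≢suc : inject₁ q ≢ suc q
  inject₁≢suc eq = ℕ.1+n≢n (trans (sym (cong toℕ eq)) (toℕ-inject₁ q))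
  regroup : ∀ t s D → + 0 + t * (-1ℤ * s * (s * (+ 1 * D))) ≡ - (t * (s * s * D))
  regroup = solve-∀

-- Matrices given by ℕ-indexed entries: for fixed a, the matrices of all T(a,b) are leading blocks
-- of one entry function.
leading : {A : Set} (n : ℕ) → (ℕ → ℕ → A) → Fin n → Fin n → A
leading n E r c = E (toℕ r) (toℕ c)

unitℕ : ℕ → ℕ → ℤ
unitℕ k c = if c ℕ.≡ᵇ k then + 1 else + 0

punchInℕ : ℕ → ℕ → ℕ
punchInℕ zero    r       = suc r
punchInℕ (suc p) zero    = zero
punchInℕ (suc p) (suc r) = suc (punchInℕ p r)

toℕ-punchIn : ∀ {n} (p : Fin (suc n)) (r : Fin n) → toℕ (punchIn p r) ≡ punchInℕ (toℕ p) (toℕ r)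
toℕ-punchIn         zero    r       = refl
toℕ-punchIn {suc n} (suc p) zero    = refl
toℕ-punchIn {suc n} (suc p) (suc r) = cong suc (toℕ-punchIn p r)

punchInℕ-< : ∀ {p r} → r ℕ.< p → punchInℕ p r ≡ r
punchInℕ-< {suc p} {zero}  _         = refl
punchInℕ-< {suc p} {suc r} (s≤s r<p) = cong suc (punchInℕ-< r<p)

punchInℕ-≥ : ∀ {p r} → p ℕ.≤ r → punchInℕ p r ≡ suc r
punchInℕ-≥ {zero}  {r}     _         = refl
punchInℕ-≥ {suc p} {suc r} (s≤s p≤r) = cong suc (punchInℕ-≥ p≤r)

punchInℕ-≢ : ∀ q c → punchInℕ q c ≢ q
punchInℕ-≢ (suc q) (suc c) eq = punchInℕ-≢ q c (ℕ.suc-injective eq)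

punchInℕ-≡ᵇ : ∀ q r c → (punchInℕ q r ℕ.≡ᵇ punchInℕ q c) ≡ (r ℕ.≡ᵇ c)
punchInℕ-≡ᵇ zero    r       c       = refl
punchInℕ-≡ᵇ (suc q) zero    zero    = refl
punchInℕ-≡ᵇ (suc q) zero    (suc c) = refl
punchInℕ-≡ᵇ (suc q) (suc r) zero    = refl
punchInℕ-≡ᵇ (suc q) (suc r) (suc c) = punchInℕ-≡ᵇ q r c

punchInℕ-suc-≡ᵇ : ∀ q r c → r ≢ q → (punchInℕ (suc q) r ℕ.≡ᵇ punchInℕ q c) ≡ (r ℕ.≡ᵇ c)
punchInℕ-suc-≡ᵇ zero    zero    c       r≢q = ⊥-elim (r≢q refl)
punchInℕ-suc-≡ᵇ zero    (suc r) c       r≢q = refl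
punchInℕ-suc-≡ᵇ (suc q) zero    zero    r≢q = refl
punchInℕ-suc-≡ᵇ (suc q) zero    (suc c) r≢q = refl
punchInℕ-suc-≡ᵇ (suc q) (suc r) zero    r≢q = refl
punchInℕ-suc-≡ᵇ (suc q) (suc r) (suc c) r≢q = punchInℕ-suc-≡ᵇ q r c (r≢q ∘ cong suc)

det-leading-cong : ∀ {n} (E E′ : ℕ → ℕ → ℤ) (p : Fin (suc n)) (p′ : ℕ) (q : Fin (suc n)) (q′ : ℕ) →
                   toℕ p ≡ p′ → toℕ q ≡ q′ →
                   (∀ r c → E (punchInℕ p′ r) (punchInℕ q′ c) ≡ E′ r c) →
                   det (deleteRowCol (leading (suc n) E) p q) ≡ det (leading n E′)
det-leading-cong E E′ p _ q _ refl refl E≗E′ =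
  det-cong λ r c → trans (cong₂ E (toℕ-punchIn p r) (toℕ-punchIn q c)) (E≗E′ (toℕ r) (toℕ c))

det-leading-diagonal-split : ∀ {n} (E E′ E″ : ℕ → ℕ → ℤ) (p : Fin (suc n)) (p′ : ℕ) (t : ℤ) → toℕ p ≡ p′ →
                             (∀ r c → r ≢ p′ → E r c ≡ E′ r c) →
                             (∀ c → E p′ c ≡ E′ p′ c + t * unitℕ p′ c) →
                             (∀ r c → E (punchInℕ p′ r) (punchInℕ p′ c) ≡ E″ r c) →
                             det (leading (suc n) E) ≡ det (leading (suc n) E′) + t * det (leading n E″)
det-leading-diagonal-split {n} E E′ E″ p _ t refl E≗E′ Eₚ E≗E″ =
  trans (det-diagonal-split (leading (suc n) E) (leading (suc n) E′) p t
                            (λ r r≢p c → E≗E′ (toℕ r) (toℕ c) (r≢p ∘ toℕ-injective)) (λ c → Eₚ (toℕ c)))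
        (cong (λ d → det (leading (suc n) E′) + t * d) (det-leading-cong E E″ p _ p _ refl refl E≗E″))

det-leading-adjacent-row-shift : ∀ {n} (E E′ : ℕ → ℕ → ℤ) (q : Fin n) (q′ : ℕ) (t : ℤ) → toℕ q ≡ q′ →
                                 (∀ c → E (suc q′) c ≡ E q′ c + t * unitℕ q′ c) →
                                 (∀ r c → E (punchInℕ (suc q′) r) (punchInℕ q′ c) ≡ E′ r c) →
                                 det (leading (suc n) E) ≡ - (t * det (leading n E′))
det-leading-adjacent-row-shift {n} E E′ q _ t refl Eq₊₁ E≗E′ =
  trans (det-adjacent-row-shift (leading (suc n) E) q t λ c →
           trans (Eq₊₁ (toℕ c)) (cong (λ k → E k (toℕ c) + t * unitℕ k (toℕ c)) (sym (toℕ-inject₁ q))))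
        (cong (λ d → - (t * d)) (det-leading-cong E E′ (suc q) _ (inject₁ q) _ refl (toℕ-inject₁ q) E≗E′))

data VertexClass : Set where
  hub centreᴬ centreᴮ leafᴬ leafᴮ : VertexClass

-- Collapsing every class to a point turns T(a,b) into the path leafᴬ – centreᴬ – hub – centreᴮ – leafᴮ.
pathPosition : VertexClass → ℕ
pathPosition leafᴬ   = 0
pathPosition centreᴬ = 1
pathPosition hub     = 2
pathPosition centreᴮ = 3
pathPosition leafᴮ   = 4

-- The distance between two distinct vertices of the given classes.
classDist : VertexClass → VertexClass → ℕ
classDist leafᴬ leafᴬ = 2
classDist leafᴮ leafᴮ = 2
classDist P     Q     = ℕ.∣ pathPosition P - pathPosition Q ∣

leafClass : ℕ → ℕ → VertexClass
leafClass zero    k       = leafᴮ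
leafClass (suc a) zero    = leafᴬ
leafClass (suc a) (suc k) = leafClass a k

vertexClass : ℕ → ℕ → VertexClass
vertexClass a 0               = hub
vertexClass a 1               = centreᴬ
vertexClass a 2               = centreᴮ
vertexClass a (suc (suc (suc k))) = leafClass a k

leafClass-< : ∀ a k → k ℕ.< a → leafClass a k ≡ leafᴬ
leafClass-< (suc a) zero    _         = refl
leafClass-< (suc a) (suc k) (s≤s k<a) = leafClass-< a k k<a

leafClass-≥ : ∀ a k → a ℕ.≤ k → leafClass a k ≡ leafᴮ
leafClass-≥ zero    k       _         = refl
leafClass-≥ (suc a) (suc k) (s≤s a≤k) = leafClass-≥ a k a≤k

vertexClass-leafᴬ : ∀ a r → 3 ℕ.≤ r → r ℕ.< 3 ℕ.+ a → vertexClass a r ≡ leafᴬ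
vertexClass-leafᴬ a (suc (suc (suc k))) (s≤s (s≤s (s≤s z≤n))) (s≤s (s≤s (s≤s k<a))) = leafClass-< a k k<a

vertexClass-leafᴮ : ∀ a r → 3 ℕ.+ a ℕ.≤ r → vertexClass a r ≡ leafᴮ
vertexClass-leafᴮ a (suc (suc (suc k))) (s≤s (s≤s (s≤s a≤k))) = leafClass-≥ a k a≤k

vertexClass-suc-< : ∀ a r → r ℕ.< 3 ℕ.+ a → vertexClass (suc a) r ≡ vertexClass a r
vertexClass-suc-< a 0 _ = refl
vertexClass-suc-< a 1 _ = refl
vertexClass-suc-< a 2 _ = refl
vertexClass-suc-< a (suc (suc (suc k))) (s≤s (s≤s (s≤s k<a))) =
  trans (leafClass-< (suc a) k (ℕ.m≤n⇒m≤1+n k<a)) (sym (leafClass-< a k k<a))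

vertexClass-suc-≥ : ∀ a r → 3 ℕ.≤ r → vertexClass (suc a) (suc r) ≡ vertexClass a r
vertexClass-suc-≥ a (suc (suc (suc k))) (s≤s (s≤s (s≤s z≤n))) = refl

vertexClass-punchIn-≥ : ∀ a L r → 3 ℕ.+ a ℕ.≤ L → vertexClass a (punchInℕ L r) ≡ vertexClass a r
vertexClass-punchIn-≥ a L r a+3≤L with r ℕ.<? L
... | yes r<L = cong (vertexClass a) (punchInℕ-< r<L)
... | no  r≮L = trans (cong (vertexClass a) (punchInℕ-≥ L≤r))
                      (trans (vertexClass-leafᴮ a (suc r) (ℕ.≤-trans a+3≤L (ℕ.≤-trans L≤r (ℕ.n≤1+n r))))
                             (sym (vertexClass-leafᴮ a r (ℕ.≤-trans a+3≤L L≤r))))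
  where L≤r = ℕ.≮⇒≥ r≮L

vertexClass-punchIn-leafᴬ : ∀ a q r → 3 ℕ.≤ q → q ℕ.≤ 3 ℕ.+ a →
                            vertexClass (suc a) (punchInℕ q r) ≡ vertexClass a r
vertexClass-punchIn-leafᴬ a q r 3≤q q≤a+3 with r ℕ.<? q
... | yes r<q = trans (cong (vertexClass (suc a)) (punchInℕ-< r<q)) (vertexClass-suc-< a r (ℕ.<-≤-trans r<q q≤a+3))
... | no  r≮q = trans (cong (vertexClass (suc a)) (punchInℕ-≥ (ℕ.≮⇒≥ r≮q)))
                      (vertexClass-suc-≥ a r (ℕ.≤-trans 3≤q (ℕ.≮⇒≥ r≮q)))

ζ : ℤ → ℤ
ζ x = - x - + 2

-- The matrices below are stated over an arbitrary carrier so that they can also be built from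
-- polynomial expressions, for the ring solver.
classMatrixOver : {A : Set} → (ℕ → A) → A → (ℕ → VertexClass) → ℕ → ℕ → A
classMatrixOver ι d κ r c = if r ℕ.≡ᵇ c then d else ι (classDist (κ r) (κ c))

replaceRow : {A : Set} → (ℕ → ℕ → A) → ℕ → (ℕ → A) → ℕ → ℕ → A
replaceRow E k u r c = if r ℕ.≡ᵇ k then u c else E r c

distRowOver : {A : Set} → (ℕ → A) → VertexClass → ℕ → ℕ → A
distRowOver ι X a c = ι (classDist X (vertexClass a c))

classMatrix : (ℕ → VertexClass) → ℤ → ℕ → ℕ → ℤ
classMatrix κ x = classMatrixOver (λ n → + n) (- x) κ

Tmatrix : ℕ → ℤ → ℕ → ℕ → ℤ
Tmatrix a = classMatrix (vertexClass a)

distRow : VertexClass → ℕ → ℕ → ℤ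
distRow = distRowOver (λ n → + n)

classMatrix-cong : ∀ κ κ′ x r r′ c c′ → (r ℕ.≡ᵇ c) ≡ (r′ ℕ.≡ᵇ c′) → κ r ≡ κ′ r′ → κ c ≡ κ′ c′ →
                   classMatrix κ x r c ≡ classMatrix κ′ x r′ c′
classMatrix-cong κ κ′ x r r′ c c′ r≡ᵇc κr κc rewrite r≡ᵇc | κr | κc = refl

classMatrix-off : ∀ κ x {r c} → r ≢ c → classMatrix κ x r c ≡ + classDist (κ r) (κ c)
classMatrix-off κ x r≢c rewrite ≡ᵇ-≢ r≢c = refl

classMatrix-leaf-row : ∀ κ x q X → κ q ≡ X → classDist X X ≡ 2 →
                       ∀ c → classMatrix κ x q c ≡ + classDist X (κ c) + ζ x * unitℕ q c
classMatrix-leaf-row κ x q X κq XX≡2 c with c ℕ.≟ q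
... | yes refl rewrite ≡ᵇ-refl c | κq | XX≡2 = diagonal x
  where
  diagonal : ∀ x → - x ≡ + 2 + (- x - + 2) * + 1
  diagonal = solve-∀
... | no c≢q rewrite ≡ᵇ-≢ (c≢q ∘ sym) | ≡ᵇ-≢ c≢q | κq =
  sym (trans (cong (_+_ (+ classDist X (κ c))) (ℤ.*-zeroʳ (ζ x))) (ℤ.+-identityʳ _))

replaceRow-self : ∀ (E : ℕ → ℕ → ℤ) k u c → replaceRow E k u k c ≡ u c
replaceRow-self E k u c rewrite ≡ᵇ-refl k = refl

replaceRow-other : ∀ (E : ℕ → ℕ → ℤ) k u {r} c → r ≢ k → replaceRow E k u r c ≡ E r c
replaceRow-other E k u c r≢k rewrite ≡ᵇ-≢ r≢k = refl

replaceRow-cong : ∀ (E E′ : ℕ → ℕ → ℤ) k k′ u u′ r r′ c c′ →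
                  (r ℕ.≡ᵇ k) ≡ (r′ ℕ.≡ᵇ k′) → u c ≡ u′ c′ → E r c ≡ E′ r′ c′ →
                  replaceRow E k u r c ≡ replaceRow E′ k′ u′ r′ c′
replaceRow-cong E E′ k k′ u u′ r r′ c c′ r≡ᵇk uc Erc rewrite r≡ᵇk = cong₂ (if r′ ℕ.≡ᵇ k′ then_else_) uc Erc

-- Row a + 2, the last leaf of the first star, replaced by the distances from a further leaf of
-- that star; its diagonal entry becomes 2.
Tmatrixᴬ : ℕ → ℤ → ℕ → ℕ → ℤ
Tmatrixᴬ a x = replaceRow (Tmatrix a x) (suc (suc a)) (distRow leafᴬ a)

Δ Δᴬ : ℕ → ℕ → ℤ → ℤ
Δ  a b x = det (leading (a ℕ.+ b ℕ.+ 3) (Tmatrix a x))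
Δᴬ a b x = det (leading (a ℕ.+ b ℕ.+ 3) (Tmatrixᴬ a x))

-- The same for the last leaf of the second star, in T(0, b + 1) and, on top of Tmatrixᴬ, in T(1, b + 1).
Δ₀ᴮ Δ₁ᴬᴮ : ℕ → ℤ → ℤ
Δ₀ᴮ  b x = det (leading (suc (b ℕ.+ 3)) (replaceRow (Tmatrix 0 x) (b ℕ.+ 3) (distRow leafᴮ 0)))
Δ₁ᴬᴮ b x = det (leading (suc (suc (b ℕ.+ 3))) (replaceRow (Tmatrixᴬ 1 x) (suc (b ℕ.+ 3)) (distRow leafᴮ 1)))

3+a≤a+b+3 : ∀ a b → 3 ℕ.+ a ℕ.≤ a ℕ.+ b ℕ.+ 3
3+a≤a+b+3 zero    b = ℕ.m≤n+m 3 b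
3+a≤a+b+3 (suc a) b = s≤s (3+a≤a+b+3 a b)

-[-t*d]≡t*d : ∀ t d → - (- t * d) ≡ t * d
-[-t*d]≡t*d t d = trans (ℤ.neg-distribˡ-* (- t) d) (cong (_* d) (ℤ.neg-involutive t))

u≡u+tv-tv : ∀ u t v → u ≡ u + t * v + - t * v
u≡u+tv-tv = solve-∀

Δ-split-leafᴬ : ∀ a b x → Δ (suc a) b x ≡ Δᴬ (suc a) b x + ζ x * Δ a b x
Δ-split-leafᴬ a b x =
  det-leading-diagonal-split (Tmatrix (suc a) x) (Tmatrixᴬ (suc a) x) (Tmatrix a x)
    (Fin.fromℕ< (s≤s (3+a≤a+b+3 a b))) q (ζ x) (toℕ-fromℕ< (s≤s (3+a≤a+b+3 a b)))
    (λ r c r≢q → sym (replaceRow-other (Tmatrix (suc a) x) q (distRow leafᴬ (suc a)) c r≢q))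
    (λ c → trans (classMatrix-leaf-row (vertexClass (suc a)) x q leafᴬ (leafClass-< (suc a) a (ℕ.n<1+n a)) refl c)
                 (cong (λ u → u + ζ x * unitℕ q c)
                       (sym (replaceRow-self (Tmatrix (suc a) x) q (distRow leafᴬ (suc a)) c))))
    (λ r c → classMatrix-cong (vertexClass (suc a)) (vertexClass a) x (punchInℕ q r) r (punchInℕ q c) c
                              (punchInℕ-≡ᵇ q r c)
                              (removeLeaf r) (removeLeaf c))
  where
  q : ℕ
  q = 3 ℕ.+ a
  removeLeaf : ∀ r → vertexClass (suc a) (punchInℕ q r) ≡ vertexClass a r
  removeLeaf r = vertexClass-punchIn-leafᴬ a q r (s≤s (s≤s (s≤s z≤n))) ℕ.≤-refl

Δᴬ-shift : ∀ a b x → Δᴬ (suc (suc a)) b x ≡ ζ x * Δᴬ (suc a) b x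
Δᴬ-shift a b x =
  trans (det-leading-adjacent-row-shift E E′ (Fin.fromℕ< (s≤s (3+a≤a+b+3 a b))) q (- ζ x)
                                        (toℕ-fromℕ< (s≤s (3+a≤a+b+3 a b))) row-q+1 deleted)
        (-[-t*d]≡t*d (ζ x) _)
  where
  q : ℕ
  q = 3 ℕ.+ a
  E E′ : ℕ → ℕ → ℤ
  E  = Tmatrixᴬ (suc (suc a)) x
  E′ = Tmatrixᴬ (suc a) x
  q≢q+1 : q ≢ suc q
  q≢q+1 eq = ℕ.1+n≢n (sym eq)
  removeLeaf : ∀ r → vertexClass (suc (suc a)) (punchInℕ q r) ≡ vertexClass (suc a) r
  removeLeaf r = vertexClass-punchIn-leafᴬ (suc a) q r (s≤s (s≤s (s≤s z≤n))) (ℕ.n≤1+n q)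
  removeLeaf′ : ∀ r → vertexClass (suc (suc a)) (punchInℕ (suc q) r) ≡ vertexClass (suc a) r
  removeLeaf′ r = vertexClass-punchIn-leafᴬ (suc a) (suc q) r (s≤s (s≤s (s≤s z≤n))) ℕ.≤-refl
  q-is-leaf : vertexClass (suc (suc a)) q ≡ leafᴬ
  q-is-leaf = leafClass-< (suc (suc a)) a (ℕ.m<n⇒m<1+n (ℕ.n<1+n a))
  row-q+1 : ∀ c → E (suc q) c ≡ E q c + - ζ x * unitℕ q c
  row-q+1 c = begin
    E (suc q) c
      ≡⟨ replaceRow-self (Tmatrix (suc (suc a)) x) (suc q) (distRow leafᴬ (suc (suc a))) c ⟩
    distRow leafᴬ (suc (suc a)) c
      ≡⟨ u≡u+tv-tv (distRow leafᴬ (suc (suc a)) c) (ζ x) (unitℕ q c) ⟩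
    distRow leafᴬ (suc (suc a)) c + ζ x * unitℕ q c + - ζ x * unitℕ q c
      ≡⟨ cong (_+ - ζ x * unitℕ q c)
              (sym (trans (replaceRow-other (Tmatrix (suc (suc a)) x) (suc q) (distRow leafᴬ (suc (suc a))) c q≢q+1)
                          (classMatrix-leaf-row (vertexClass (suc (suc a))) x q leafᴬ q-is-leaf refl c))) ⟩
    E q c + - ζ x * unitℕ q c ∎
    where open ≡-Reasoning
  deleted : ∀ r c → E (punchInℕ (suc q) r) (punchInℕ q c) ≡ E′ r c
  deleted r c with r ℕ.≟ q
  ... | yes refl = begin
    E (punchInℕ (suc q) q) (punchInℕ q c)
      ≡⟨ cong (λ k → E k (punchInℕ q c)) (punchInℕ-< (ℕ.n<1+n q)) ⟩
    E q (punchInℕ q c)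
      ≡⟨ replaceRow-other (Tmatrix (suc (suc a)) x) (suc q) (distRow leafᴬ (suc (suc a))) (punchInℕ q c) q≢q+1 ⟩
    Tmatrix (suc (suc a)) x q (punchInℕ q c)
      ≡⟨ classMatrix-off (vertexClass (suc (suc a))) x (punchInℕ-≢ q c ∘ sym) ⟩
    + classDist (vertexClass (suc (suc a)) q) (vertexClass (suc (suc a)) (punchInℕ q c))
      ≡⟨ cong₂ (λ X Y → + classDist X Y) q-is-leaf (removeLeaf c) ⟩
    distRow leafᴬ (suc a) c
      ≡⟨ sym (replaceRow-self (Tmatrix (suc a) x) q (distRow leafᴬ (suc a)) c) ⟩
    E′ q c ∎
    where open ≡-Reasoning
  ... | no r≢q = begin
    E (punchInℕ (suc q) r) (punchInℕ q c)
      ≡⟨ replaceRow-other (Tmatrix (suc (suc a)) x) (suc q) (distRow leafᴬ (suc (suc a))) (punchInℕ q c)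
                          (punchInℕ-≢ (suc q) r) ⟩
    Tmatrix (suc (suc a)) x (punchInℕ (suc q) r) (punchInℕ q c)
      ≡⟨ classMatrix-cong (vertexClass (suc (suc a))) (vertexClass (suc a)) x (punchInℕ (suc q) r) r (punchInℕ q c) c
                          (punchInℕ-suc-≡ᵇ q r c r≢q) (removeLeaf′ r) (removeLeaf c) ⟩
    Tmatrix (suc a) x r c
      ≡⟨ sym (replaceRow-other (Tmatrix (suc a) x) q (distRow leafᴬ (suc a)) c r≢q) ⟩
    E′ r c ∎
    where open ≡-Reasoning

det-split-last-row : ∀ (H : ℕ → ℕ → ℤ) (u : ℕ → ℤ) t L →
                     (∀ r c → H (punchInℕ L r) (punchInℕ L c) ≡ H r c) →
                     (∀ c → H L c ≡ u c + t * unitℕ L c) →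
                     det (leading (suc L) H) ≡ det (leading (suc L) (replaceRow H L u)) + t * det (leading L H)
det-split-last-row H u t L H≗H HL =
  det-leading-diagonal-split H (replaceRow H L u) H (Fin.fromℕ L) L t (toℕ-fromℕ L)
    (λ r c r≢L → sym (replaceRow-other H L u c r≢L))
    (λ c → trans (HL c) (cong (λ v → v + t * unitℕ L c) (sym (replaceRow-self H L u c))))
    H≗H

det-shift-last-row : ∀ (H : ℕ → ℕ → ℤ) (u : ℕ → ℤ) t L →
                     (∀ c → u (punchInℕ L c) ≡ u c) →
                     (∀ c → H L c ≡ u c + t * unitℕ L c) →
                     (∀ r c → r ≢ L → H (punchInℕ (suc L) r) (punchInℕ L c) ≡ H r c) →
                     det (leading (suc (suc L)) (replaceRow H (suc L) u))
                       ≡ t * det (leading (suc L) (replaceRow H L u))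
det-shift-last-row H u t L u≗u HL H≗H =
  trans (det-leading-adjacent-row-shift E E′ (Fin.fromℕ L) L (- t) (toℕ-fromℕ L) row-L+1 deleted)
        (-[-t*d]≡t*d t _)
  where
  E E′ : ℕ → ℕ → ℤ
  E  = replaceRow H (suc L) u
  E′ = replaceRow H L u
  L≢L+1 : L ≢ suc L
  L≢L+1 eq = ℕ.1+n≢n (sym eq)
  row-L+1 : ∀ c → E (suc L) c ≡ E L c + - t * unitℕ L c
  row-L+1 c = begin
    E (suc L) c                          ≡⟨ replaceRow-self H (suc L) u c ⟩
    u c                                  ≡⟨ u≡u+tv-tv (u c) t (unitℕ L c) ⟩
    u c + t * unitℕ L c + - t * unitℕ L c ≡⟨ cong (_+ - t * unitℕ L c)
                                                 (sym (trans (replaceRow-other H (suc L) u c L≢L+1) (HL c))) ⟩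
    E L c + - t * unitℕ L c              ∎
    where open ≡-Reasoning
  deleted : ∀ r c → E (punchInℕ (suc L) r) (punchInℕ L c) ≡ E′ r c
  deleted r c with r ℕ.≟ L
  ... | yes refl = begin
    E (punchInℕ (suc L) L) (punchInℕ L c)
      ≡⟨ cong (λ k → E k (punchInℕ L c)) (punchInℕ-< (ℕ.n<1+n L)) ⟩
    E L (punchInℕ L c)
      ≡⟨ trans (replaceRow-other H (suc L) u (punchInℕ L c) L≢L+1) (HL (punchInℕ L c)) ⟩
    u (punchInℕ L c) + t * unitℕ L (punchInℕ L c)
      ≡⟨ cong₂ (λ v w → v + t * w) (u≗u c) (cong (if_then + 1 else + 0) (≡ᵇ-≢ (punchInℕ-≢ L c))) ⟩
    u c + t * + 0
      ≡⟨ trans (cong (_+_ (u c)) (ℤ.*-zeroʳ t)) (ℤ.+-identityʳ (u c)) ⟩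
    u c
      ≡⟨ sym (replaceRow-self H L u c) ⟩
    E′ L c ∎
    where open ≡-Reasoning
  ... | no r≢L = trans (replaceRow-other H (suc L) u (punchInℕ L c) (punchInℕ-≢ (suc L) r))
                       (trans (H≗H r c r≢L) (sym (replaceRow-other H L u c r≢L)))

punchInℕ-≡ᵇ-< : ∀ {k q} r → k ℕ.< q → (punchInℕ q r ℕ.≡ᵇ k) ≡ (r ℕ.≡ᵇ k)
punchInℕ-≡ᵇ-< {k} {q} r k<q = trans (cong (punchInℕ q r ℕ.≡ᵇ_) (sym (punchInℕ-< k<q))) (punchInℕ-≡ᵇ q r k)

module _ (a : ℕ) (x : ℤ) (L : ℕ) (a+3≤L : 3 ℕ.+ a ℕ.≤ L) where

  private
    beyond : ∀ r → vertexClass a (punchInℕ L r) ≡ vertexClass a r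
    beyond r = vertexClass-punchIn-≥ a L r a+3≤L
    beyond′ : ∀ r → vertexClass a (punchInℕ (suc L) r) ≡ vertexClass a r
    beyond′ r = vertexClass-punchIn-≥ a (suc L) r (ℕ.m≤n⇒m≤1+n a+3≤L)

  distRow-punchIn-≥ : ∀ X c → distRow X a (punchInℕ L c) ≡ distRow X a c
  distRow-punchIn-≥ X c = cong (+_ ∘ classDist X) (beyond c)

  Tmatrix-leafᴮ-row : ∀ c → Tmatrix a x L c ≡ distRow leafᴮ a c + ζ x * unitℕ L c
  Tmatrix-leafᴮ-row = classMatrix-leaf-row (vertexClass a) x L leafᴮ (vertexClass-leafᴮ a L a+3≤L) refl

  Tmatrix-punchIn-≥ : ∀ r c → Tmatrix a x (punchInℕ L r) (punchInℕ L c) ≡ Tmatrix a x r c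
  Tmatrix-punchIn-≥ r c =
    classMatrix-cong (vertexClass a) (vertexClass a) x (punchInℕ L r) r (punchInℕ L c) c
                     (punchInℕ-≡ᵇ L r c) (beyond r) (beyond c)

  Tmatrix-punchIn-suc-≥ : ∀ r c → r ≢ L → Tmatrix a x (punchInℕ (suc L) r) (punchInℕ L c) ≡ Tmatrix a x r c
  Tmatrix-punchIn-suc-≥ r c r≢L =
    classMatrix-cong (vertexClass a) (vertexClass a) x (punchInℕ (suc L) r) r (punchInℕ L c) c
                     (punchInℕ-suc-≡ᵇ L r c r≢L) (beyond′ r) (beyond c)

  private
    a+2<L : suc (suc a) ℕ.< L
    a+2<L = a+3≤L

  Tmatrixᴬ-leafᴮ-row : ∀ c → Tmatrixᴬ a x L c ≡ distRow leafᴮ a c + ζ x * unitℕ L c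
  Tmatrixᴬ-leafᴮ-row c = trans (replaceRow-other (Tmatrix a x) (suc (suc a)) (distRow leafᴬ a) c (ℕ.>⇒≢ a+2<L))
                               (Tmatrix-leafᴮ-row c)

  Tmatrixᴬ-punchIn-≥ : ∀ r c → Tmatrixᴬ a x (punchInℕ L r) (punchInℕ L c) ≡ Tmatrixᴬ a x r c
  Tmatrixᴬ-punchIn-≥ r c =
    replaceRow-cong (Tmatrix a x) (Tmatrix a x) (suc (suc a)) (suc (suc a)) (distRow leafᴬ a) (distRow leafᴬ a)
                    (punchInℕ L r) r (punchInℕ L c) c
                    (punchInℕ-≡ᵇ-< r a+2<L) (distRow-punchIn-≥ leafᴬ c) (Tmatrix-punchIn-≥ r c)

  Tmatrixᴬ-punchIn-suc-≥ : ∀ r c → r ≢ L → Tmatrixᴬ a x (punchInℕ (suc L) r) (punchInℕ L c) ≡ Tmatrixᴬ a x r c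
  Tmatrixᴬ-punchIn-suc-≥ r c r≢L =
    replaceRow-cong (Tmatrix a x) (Tmatrix a x) (suc (suc a)) (suc (suc a)) (distRow leafᴬ a) (distRow leafᴬ a)
                    (punchInℕ (suc L) r) r (punchInℕ L c) c
                    (punchInℕ-≡ᵇ-< r (ℕ.m<n⇒m<1+n a+2<L)) (distRow-punchIn-≥ leafᴬ c) (Tmatrix-punchIn-suc-≥ r c r≢L)

3≤b+3 : ∀ b → 3 ℕ.≤ b ℕ.+ 3
3≤b+3 b = ℕ.m≤n+m 3 b

Δ₀-split-leafᴮ : ∀ b x → Δ 0 (suc b) x ≡ Δ₀ᴮ b x + ζ x * Δ 0 b x
Δ₀-split-leafᴮ b x = det-split-last-row (Tmatrix 0 x) (distRow leafᴮ 0) (ζ x) (b ℕ.+ 3)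
  (Tmatrix-punchIn-≥ 0 x (b ℕ.+ 3) (3≤b+3 b)) (Tmatrix-leafᴮ-row 0 x (b ℕ.+ 3) (3≤b+3 b))

Δ₀ᴮ-shift : ∀ b x → Δ₀ᴮ (suc b) x ≡ ζ x * Δ₀ᴮ b x
Δ₀ᴮ-shift b x = det-shift-last-row (Tmatrix 0 x) (distRow leafᴮ 0) (ζ x) (b ℕ.+ 3)
  (distRow-punchIn-≥ 0 x (b ℕ.+ 3) (3≤b+3 b) leafᴮ) (Tmatrix-leafᴮ-row 0 x (b ℕ.+ 3) (3≤b+3 b))
  (Tmatrix-punchIn-suc-≥ 0 x (b ℕ.+ 3) (3≤b+3 b))

Δᴬ₁-split-leafᴮ : ∀ b x → Δᴬ 1 (suc b) x ≡ Δ₁ᴬᴮ b x + ζ x * Δᴬ 1 b x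
Δᴬ₁-split-leafᴮ b x = det-split-last-row (Tmatrixᴬ 1 x) (distRow leafᴮ 1) (ζ x) (suc (b ℕ.+ 3))
  (Tmatrixᴬ-punchIn-≥ 1 x (suc (b ℕ.+ 3)) (s≤s (3≤b+3 b))) (Tmatrixᴬ-leafᴮ-row 1 x (suc (b ℕ.+ 3)) (s≤s (3≤b+3 b)))

Δ₁ᴬᴮ-shift : ∀ b x → Δ₁ᴬᴮ (suc b) x ≡ ζ x * Δ₁ᴬᴮ b x
Δ₁ᴬᴮ-shift b x = det-shift-last-row (Tmatrixᴬ 1 x) (distRow leafᴮ 1) (ζ x) (suc (b ℕ.+ 3))
  (distRow-punchIn-≥ 1 x (suc (b ℕ.+ 3)) (s≤s (3≤b+3 b)) leafᴮ)
  (Tmatrixᴬ-leafᴮ-row 1 x (suc (b ℕ.+ 3)) (s≤s (3≤b+3 b)))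
  (Tmatrixᴬ-punchIn-suc-≥ 1 x (suc (b ℕ.+ 3)) (s≤s (3≤b+3 b)))

detᴾ : ∀ {n m} → (Fin n → Fin n → Polynomial m) → Polynomial m
detᴾ {zero}  M = con (+ 1)
detᴾ {suc n} M = sumᴾ λ j → con (-1ℤ ^ toℕ j) :* (M zero j :* detᴾ (λ r c → M (suc r) (punchIn j c)))
  where
  sumᴾ : ∀ {n m} → (Fin n → Polynomial m) → Polynomial m
  sumᴾ {zero}  f = con (+ 0)
  sumᴾ {suc n} f = f zero :+ sumᴾ (f ∘ suc)

φ₀ᴾ φ₁ᴾ φ₂ᴾ ζᴾ : ∀ {m} → Polynomial m → Polynomial m
φ₀ᴾ X = con (+ 4) :+ con (+ 6) :* X :- X :^ 3
φ₁ᴾ X = :- con (+ 4) :- con (+ 16) :* X :- con (+ 14) :* X :^ 2 :- con (+ 2) :* X :^ 3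
φ₂ᴾ X = con (+ 8) :* X :+ con (+ 24) :* X :^ 2 :+ con (+ 12) :* X :^ 3
ζᴾ  X = :- X :- con (+ 2)

φ₀ φ₁ φ₂ : ℤ → ℤ
φ₀ x = ⟦ φ₀ᴾ (var zero) ⟧ (x ∷ [])
φ₁ x = ⟦ φ₁ᴾ (var zero) ⟧ (x ∷ [])
φ₂ x = ⟦ φ₂ᴾ (var zero) ⟧ (x ∷ [])

-- For matrices of fixed size, ⟦ detᴾ M ⟧ evaluates to det of the evaluated entries, so the
-- polynomial solver can expand the four base determinants.
module _ (X : Polynomial 1) where
  private
    Tᴾ : ℕ → ℕ → ℕ → Polynomial 1
    Tᴾ a = classMatrixOver (λ n → con (+ n)) (:- X) (vertexClass a)
    distRowᴾ : VertexClass → ℕ → ℕ → Polynomial 1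
    distRowᴾ = distRowOver (λ n → con (+ n))
    Tᴬᴾ : ℕ → ℕ → ℕ → Polynomial 1
    Tᴬᴾ a = replaceRow (Tᴾ a) (suc (suc a)) (distRowᴾ leafᴬ a)

  Δ-0-0ᴾ Δ₀ᴮ-0ᴾ Δᴬ-1-0ᴾ Δ₁ᴬᴮ-0ᴾ : Polynomial 1 × Polynomial 1
  Δ-0-0ᴾ   = detᴾ (leading 3 (Tᴾ 0)) := φ₀ᴾ X
  Δ₀ᴮ-0ᴾ   = detᴾ (leading 4 (replaceRow (Tᴾ 0) 3 (distRowᴾ leafᴮ 0))) := φ₁ᴾ X
  Δᴬ-1-0ᴾ  = detᴾ (leading 4 (Tᴬᴾ 1)) := φ₁ᴾ X
  Δ₁ᴬᴮ-0ᴾ  = detᴾ (leading 5 (replaceRow (Tᴬᴾ 1) 4 (distRowᴾ leafᴮ 1))) := φ₂ᴾ X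

Δ-0-0 : ∀ x → Δ 0 0 x ≡ φ₀ x
Δ-0-0 = solve 1 Δ-0-0ᴾ refl

Δ₀ᴮ-0 : ∀ x → Δ₀ᴮ 0 x ≡ φ₁ x
Δ₀ᴮ-0 = solve 1 Δ₀ᴮ-0ᴾ refl

Δᴬ-1-0 : ∀ x → Δᴬ 1 0 x ≡ φ₁ x
Δᴬ-1-0 = solve 1 Δᴬ-1-0ᴾ refl

Δ₁ᴬᴮ-0 : ∀ x → Δ₁ᴬᴮ 0 x ≡ φ₂ x
Δ₁ᴬᴮ-0 = solve 1 Δ₁ᴬᴮ-0ᴾ refl

geometric : ∀ w (Y : ℕ → ℤ) → (∀ n → Y (suc n) ≡ w * Y n) → ∀ n → Y n ≡ w ^ n * Y 0
geometric w Y Y-step zero    = sym (ℤ.*-identityˡ (Y 0))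
geometric w Y Y-step (suc n) =
  trans (Y-step n) (trans (cong (w *_) (geometric w Y Y-step n)) (sym (ℤ.*-assoc w (w ^ n) (Y 0))))

-- X n = Y (n - 1) + w Y (n - 2) + … + wⁿ⁻¹ Y 0 + wⁿ X 0 with Y geometric.
linear-recurrence : ∀ w (X Y : ℕ → ℤ) → (∀ n → Y (suc n) ≡ w * Y n) → (∀ n → X (suc n) ≡ Y n + w * X n) →
                    ∀ n → X n ≡ w ^ (n ∸ 1) * (w ^ (1 ⊓ n) * X 0 + + n * Y 0)
linear-recurrence w X Y Y-step X-step zero = initial (X 0) (Y 0)
  where
  initial : ∀ X Y → X ≡ + 1 * (+ 1 * X + + 0 * Y)
  initial = solve-∀
linear-recurrence w X Y Y-step X-step (suc zero) = trans (X-step 0) (first w (X 0) (Y 0))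
  where
  first : ∀ w X Y → Y + w * X ≡ + 1 * (w * + 1 * X + + 1 * Y)
  first = solve-∀
linear-recurrence w X Y Y-step X-step (suc (suc n)) = begin
  X (2 ℕ.+ n)
    ≡⟨ X-step (suc n) ⟩
  Y (suc n) + w * X (suc n)
    ≡⟨ cong₂ (λ y x → y + w * x) (geometric w Y Y-step (suc n)) (linear-recurrence w X Y Y-step X-step (suc n)) ⟩
  w * w ^ n * Y 0 + w * (w ^ n * (w * + 1 * X 0 + + suc n * Y 0))
    ≡⟨ regroup w (w ^ n) (X 0) (Y 0) (+ suc n) ⟩
  w * w ^ n * (w * + 1 * X 0 + (+ 1 + + suc n) * Y 0) ∎
  where
  open ≡-Reasoning
  regroup : ∀ w P X Y N → w * P * Y + w * (P * (w * + 1 * X + N * Y)) ≡ w * P * (w * + 1 * X + (+ 1 + N) * Y)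
  regroup = solve-∀

Δ₀-closed : ∀ b x → Δ 0 b x ≡ ζ x ^ (b ∸ 1) * (ζ x ^ (1 ⊓ b) * φ₀ x + + b * φ₁ x)
Δ₀-closed b x =
  trans (linear-recurrence (ζ x) (λ b → Δ 0 b x) (λ b → Δ₀ᴮ b x)
                           (λ b → Δ₀ᴮ-shift b x) (λ b → Δ₀-split-leafᴮ b x) b)
        (cong₂ (λ u v → ζ x ^ (b ∸ 1) * (ζ x ^ (1 ⊓ b) * u + + b * v)) (Δ-0-0 x) (Δ₀ᴮ-0 x))

Δᴬ₁-closed : ∀ b x → Δᴬ 1 b x ≡ ζ x ^ (b ∸ 1) * (ζ x ^ (1 ⊓ b) * φ₁ x + + b * φ₂ x)
Δᴬ₁-closed b x =
  trans (linear-recurrence (ζ x) (λ b → Δᴬ 1 b x) (λ b → Δ₁ᴬᴮ b x)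
                           (λ b → Δ₁ᴬᴮ-shift b x) (λ b → Δᴬ₁-split-leafᴮ b x) b)
        (cong₂ (λ u v → ζ x ^ (b ∸ 1) * (ζ x ^ (1 ⊓ b) * u + + b * v)) (Δᴬ-1-0 x) (Δ₁ᴬᴮ-0 x))

Δ-closed : ∀ a b x → Δ a b x ≡ ζ x ^ (a ∸ 1) * (ζ x ^ (1 ⊓ a) * Δ 0 b x + + a * Δᴬ 1 b x)
Δ-closed a b x =
  linear-recurrence (ζ x) (λ a → Δ a b x) (λ a → Δᴬ (suc a) b x)
                    (λ a → Δᴬ-shift a b x) (λ a → Δ-split-leafᴬ a b x) a

-- The factor shared by Δ a b x and p a b x.
corePoly : ℕ → ℕ → ℤ → ℤ
corePoly a b x = ζ x ^ (1 ⊓ a) * (ζ x ^ (1 ⊓ b) * φ₀ x + + b * φ₁ x) + + a * (ζ x ^ (1 ⊓ b) * φ₁ x + + b * φ₂ x)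

Δ-factorisation : ∀ a b x → Δ a b x ≡ ζ x ^ (a ∸ 1) * ζ x ^ (b ∸ 1) * corePoly a b x
Δ-factorisation a b x = begin
  Δ a b x
    ≡⟨ Δ-closed a b x ⟩
  w ^ (a ∸ 1) * (w ^ (1 ⊓ a) * Δ 0 b x + + a * Δᴬ 1 b x)
    ≡⟨ cong₂ (λ u v → w ^ (a ∸ 1) * (w ^ (1 ⊓ a) * u + + a * v)) (Δ₀-closed b x) (Δᴬ₁-closed b x) ⟩
  w ^ (a ∸ 1) * (w ^ (1 ⊓ a) * (w ^ (b ∸ 1) * (w ^ (1 ⊓ b) * φ₀ x + + b * φ₁ x))
                 + + a * (w ^ (b ∸ 1) * (w ^ (1 ⊓ b) * φ₁ x + + b * φ₂ x)))
    ≡⟨ regroup (w ^ (a ∸ 1)) (w ^ (b ∸ 1)) (w ^ (1 ⊓ a)) (w ^ (1 ⊓ b)) (+ a) (+ b) (φ₀ x) (φ₁ x) (φ₂ x) ⟩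
  w ^ (a ∸ 1) * w ^ (b ∸ 1) * corePoly a b x ∎
  where
  open ≡-Reasoning
  w : ℤ
  w = ζ x
  regroup : ∀ P Q ca cb A B f g h →
            P * (ca * (Q * (cb * f + B * g)) + A * (Q * (cb * g + B * h)))
              ≡ P * Q * (ca * (cb * f + B * g) + A * (cb * g + B * h))
  regroup = solve-∀

pᴾ : ∀ {m} → Polynomial m → Polynomial m → Polynomial m → Polynomial m
pᴾ A B X =
  con (+ 16) :+ con (+ 8) :* A :+ con (+ 8) :* B
  :+ con (+ 40) :* X :+ con (+ 36) :* A :* X :+ con (+ 36) :* B :* X :+ con (+ 8) :* A :* B :* X
  :+ con (+ 28) :* X :^ 2 :+ con (+ 44) :* A :* X :^ 2 :+ con (+ 44) :* B :* X :^ 2 :+ con (+ 24) :* A :* B :* X :^ 2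
  :+ con (+ 2) :* X :^ 3 :+ con (+ 18) :* A :* X :^ 3 :+ con (+ 18) :* B :* X :^ 3 :+ con (+ 12) :* A :* B :* X :^ 3
  :- con (+ 4) :* X :^ 4 :+ con (+ 2) :* A :* X :^ 4 :+ con (+ 2) :* B :* X :^ 4
  :- X :^ 5

p-symmetric-form : ∀ a b x → p a b x ≡ ζ x * ζ x * φ₀ x + (+ a * ζ x + ζ x * + b) * φ₁ x + + a * + b * φ₂ x
p-symmetric-form a b = solve 3 (λ A B X → pᴾ A B X := ζᴾ X :* ζᴾ X :* φ₀ᴾ X :+ (A :* ζᴾ X :+ ζᴾ X :* B) :* φ₁ᴾ X
                                                       :+ A :* B :* φ₂ᴾ X)
                               refl (+ a) (+ b)

w^[1∸n]*w^[1⊓n]≡w : ∀ w n → w ^ (1 ∸ n) * w ^ (1 ⊓ n) ≡ w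
w^[1∸n]*w^[1⊓n]≡w w zero    = trans (ℤ.*-identityʳ (w ^ 1)) (ℤ.*-identityʳ w)
w^[1∸n]*w^[1⊓n]≡w w (suc n) rewrite ℕ.0∸n≡0 n = trans (ℤ.*-identityˡ (w ^ 1)) (ℤ.*-identityʳ w)

n*w^[1∸n]≡n : ∀ w n → + n * w ^ (1 ∸ n) ≡ + n
n*w^[1∸n]≡n w zero    = ℤ.*-zeroˡ (w ^ 1)
n*w^[1∸n]≡n w (suc n) rewrite ℕ.0∸n≡0 n = ℤ.*-identityʳ (+ suc n)

p-factorisation : ∀ a b x → p a b x ≡ ζ x ^ (1 ∸ a) * ζ x ^ (1 ∸ b) * corePoly a b x
p-factorisation a b x = begin
  p a b x
    ≡⟨ p-symmetric-form a b x ⟩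
  w * w * φ₀ x + (+ a * w + w * + b) * φ₁ x + + a * + b * φ₂ x
    ≡⟨ cong₂ (λ u v → u * v * φ₀ x + (+ a * v + u * + b) * φ₁ x + + a * + b * φ₂ x)
             (sym (w^[1∸n]*w^[1⊓n]≡w w a)) (sym (w^[1∸n]*w^[1⊓n]≡w w b)) ⟩
  (Pa * Ca) * (Pb * Cb) * φ₀ x + (+ a * (Pb * Cb) + (Pa * Ca) * + b) * φ₁ x + + a * + b * φ₂ x
    ≡⟨ cong₂ (λ u v → (Pa * Ca) * (Pb * Cb) * φ₀ x + (u * (Pb * Cb) + (Pa * Ca) * v) * φ₁ x + u * v * φ₂ x)
             (sym (n*w^[1∸n]≡n w a)) (sym (n*w^[1∸n]≡n w b)) ⟩
  (Pa * Ca) * (Pb * Cb) * φ₀ x + (+ a * Pa * (Pb * Cb) + (Pa * Ca) * (+ b * Pb)) * φ₁ x + + a * Pa * (+ b * Pb) * φ₂ x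
    ≡⟨ regroup Pa Pb Ca Cb (+ a) (+ b) (φ₀ x) (φ₁ x) (φ₂ x) ⟩
  Pa * Pb * corePoly a b x ∎
  where
  open ≡-Reasoning
  w Pa Pb Ca Cb : ℤ
  w  = ζ x
  Pa = w ^ (1 ∸ a)
  Pb = w ^ (1 ∸ b)
  Ca = w ^ (1 ⊓ a)
  Cb = w ^ (1 ⊓ b)
  regroup : ∀ Pa Pb Ca Cb A B f g h →
            (Pa * Ca) * (Pb * Cb) * f + (A * Pa * (Pb * Cb) + (Pa * Ca) * (B * Pb)) * g + A * Pa * (B * Pb) * h
              ≡ Pa * Pb * (Ca * (Cb * f + B * g) + A * (Cb * g + B * h))
  regroup = solve-∀

exponent-balance : ∀ a b → (2 ∸ (a ℕ.+ b)) ℕ.+ ((a ∸ 1) ℕ.+ (b ∸ 1)) ≡ ((a ℕ.+ b) ∸ 2) ℕ.+ ((1 ∸ a) ℕ.+ (1 ∸ b))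
exponent-balance zero          zero          = refl
exponent-balance zero          (suc zero)    = refl
exponent-balance zero          (suc (suc b)) rewrite ℕ.0∸n≡0 b = ℕ.+-comm 1 b
exponent-balance (suc zero)    zero          = refl
exponent-balance (suc zero)    (suc b)       = ℕ.+-comm (0 ∸ b) b
exponent-balance (suc (suc a)) zero          rewrite ℕ.+-identityʳ a | ℕ.0∸n≡0 a = ℕ.+-comm 1 a
exponent-balance (suc (suc a)) (suc b)       rewrite ℕ.0∸n≡0 (a ℕ.+ suc b) | ℕ.0∸n≡0 b =
  trans (sym (ℕ.+-suc a b)) (sym (ℕ.+-identityʳ (a ℕ.+ suc b)))

T-∧ˡ : ∀ x {y} → T (x ∧ y) → T x
T-∧ˡ x = proj₁ ∘ Equivalence.to (T-∧ {x})

T-∧ʳ : ∀ x {y} → T (x ∧ y) → T y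
T-∧ʳ x = proj₂ ∘ Equivalence.to (T-∧ {x})

forAllClasses : (VertexClass → Bool) → Bool
forAllClasses f = f hub ∧ f centreᴬ ∧ f centreᴮ ∧ f leafᴬ ∧ f leafᴮ

forAllClasses-sound : ∀ f → T (forAllClasses f) → ∀ X → T (f X)
forAllClasses-sound f all hub     = T-∧ˡ (f hub) all
forAllClasses-sound f all centreᴬ = T-∧ˡ (f centreᴬ) (T-∧ʳ (f hub) all)
forAllClasses-sound f all centreᴮ = T-∧ˡ (f centreᴮ) (T-∧ʳ (f centreᴬ) (T-∧ʳ (f hub) all))
forAllClasses-sound f all leafᴬ   = T-∧ˡ (f leafᴬ) (T-∧ʳ (f centreᴮ) (T-∧ʳ (f centreᴬ) (T-∧ʳ (f hub) all)))
forAllClasses-sound f all leafᴮ   = T-∧ʳ (f leafᴬ) (T-∧ʳ (f centreᴮ) (T-∧ʳ (f centreᴬ) (T-∧ʳ (f hub) all)))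

-- Edges of T(a,b) join classes at consecutive positions on the path.
adjacentᵇ : VertexClass → VertexClass → Bool
adjacentᵇ P Q = ℕ.∣ pathPosition P - pathPosition Q ∣ ℕ.≡ᵇ 1

classDist-adjacent-checkᵇ : VertexClass → VertexClass → VertexClass → Bool
classDist-adjacent-checkᵇ P Q X =
  if adjacentᵇ P Q then (classDist P Q ℕ.≤ᵇ 1) ∧ (classDist P X ℕ.≤ᵇ suc (classDist Q X)) else true

classDist-adjacent-checked : ∀ P Q X → T (classDist-adjacent-checkᵇ P Q X)
classDist-adjacent-checked P Q =
  forAllClasses-sound (classDist-adjacent-checkᵇ P Q)
    (forAllClasses-sound (λ Q → forAllClasses (classDist-adjacent-checkᵇ P Q))
      (forAllClasses-sound (λ P → forAllClasses λ Q → forAllClasses (classDist-adjacent-checkᵇ P Q)) _ P) Q)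

classDist-adjacent : ∀ P Q X → T (adjacentᵇ P Q) →
                     classDist P Q ℕ.≤ 1 × classDist P X ℕ.≤ suc (classDist Q X)
classDist-adjacent P Q X adj = ℕ.≤ᵇ⇒≤ _ _ (T-∧ˡ (classDist P Q ℕ.≤ᵇ 1) checked)
                             , ℕ.≤ᵇ⇒≤ _ _ (T-∧ʳ (classDist P Q ℕ.≤ᵇ 1) checked)
  where
  T-if : ∀ {b c} → T b → T (if b then c else true) → T c
  T-if {true} _ c = c
  checked : T ((classDist P Q ℕ.≤ᵇ 1) ∧ (classDist P X ℕ.≤ᵇ suc (classDist Q X)))
  checked = T-if adj (classDist-adjacent-checked P Q X)

vertexDist : ℕ → ℕ → ℕ → ℕ
vertexDist a r c = if r ℕ.≡ᵇ c then 0 else classDist (vertexClass a r) (vertexClass a c)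

edge-adjacent : ∀ {a b r s} → TEdge a b r s →
                T (adjacentᵇ (vertexClass a r) (vertexClass a s)) × T (adjacentᵇ (vertexClass a s) (vertexClass a r))
edge-adjacent         e01                   = _ , _
edge-adjacent         e02                   = _ , _
edge-adjacent {a} (e1 k 3≤k k<a+3) rewrite vertexClass-leafᴬ a k 3≤k k<a+3 = _ , _
edge-adjacent {a} (e2 k a+3≤k _)   rewrite vertexClass-leafᴮ a k a+3≤k     = _ , _

vertexDist-adjacent : ∀ a r s v → T (adjacentᵇ (vertexClass a r) (vertexClass a s)) →
                      vertexDist a r v ℕ.≤ suc (vertexDist a s v)
vertexDist-adjacent a r s v adj with v ℕ.≟ r
... | yes refl rewrite ≡ᵇ-refl v = z≤n
... | no v≢r rewrite ≡ᵇ-≢ (v≢r ∘ sym) with v ℕ.≟ s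
...   | yes refl rewrite ≡ᵇ-refl v =
  proj₁ (classDist-adjacent (vertexClass a r) (vertexClass a v) (vertexClass a v) adj)
...   | no v≢s rewrite ≡ᵇ-≢ (v≢s ∘ sym) =
  proj₂ (classDist-adjacent (vertexClass a r) (vertexClass a s) (vertexClass a v) adj)

module _ (a b : ℕ) where

  private
    N : ℕ
    N = a ℕ.+ b ℕ.+ 3

    Adj : Fin N → Fin N → Set
    Adj = TAdj a b

  walk-length-≥ : ∀ {u v m} → Walk Adj u v m → vertexDist a (toℕ u) (toℕ v) ℕ.≤ m
  walk-length-≥ {u} here rewrite ≡ᵇ-refl (toℕ u) = z≤n
  walk-length-≥ {u} {v} (step {v = w} u~w walk) =
    ℕ.≤-trans (vertexDist-adjacent a (toℕ u) (toℕ w) (toℕ v) (adjacent u~w)) (s≤s (walk-length-≥ walk))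
    where
    adjacent : ∀ {u w} → Adj u w → T (adjacentᵇ (vertexClass a (toℕ u)) (vertexClass a (toℕ w)))
    adjacent (inj₁ e) = proj₁ (edge-adjacent e)
    adjacent (inj₂ e) = proj₂ (edge-adjacent e)

  private
    3≤N : 3 ℕ.≤ N
    3≤N = ℕ.m≤n+m 3 (a ℕ.+ b)

    hubV centreᴬV centreᴮV : Fin N
    hubV     = Fin.fromℕ< {0} (ℕ.≤-trans (s≤s z≤n) 3≤N)
    centreᴬV = Fin.fromℕ< {1} (ℕ.≤-trans (s≤s (s≤s z≤n)) 3≤N)
    centreᴮV = Fin.fromℕ< {2} 3≤N

    toℕ-hubV : toℕ hubV ≡ 0
    toℕ-hubV = toℕ-fromℕ< _
    toℕ-centreᴬV : toℕ centreᴬV ≡ 1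
    toℕ-centreᴬV = toℕ-fromℕ< _
    toℕ-centreᴮV : toℕ centreᴮV ≡ 2
    toℕ-centreᴮV = toℕ-fromℕ< _

    edge : ∀ {u w r s} → toℕ u ≡ r → toℕ w ≡ s → TEdge a b r s → Adj u w
    edge refl refl e = inj₁ e

    edge⁻¹ : ∀ {u w r s} → toℕ u ≡ r → toℕ w ≡ s → TEdge a b s r → Adj u w
    edge⁻¹ refl refl e = inj₂ e

    hub~centreᴬ : Adj hubV centreᴬV
    hub~centreᴬ = edge toℕ-hubV toℕ-centreᴬV e01
    centreᴬ~hub : Adj centreᴬV hubV
    centreᴬ~hub = edge⁻¹ toℕ-centreᴬV toℕ-hubV e01
    hub~centreᴮ : Adj hubV centreᴮV
    hub~centreᴮ = edge toℕ-hubV toℕ-centreᴮV e02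
    centreᴮ~hub : Adj centreᴮV hubV
    centreᴮ~hub = edge⁻¹ toℕ-centreᴮV toℕ-hubV e02

    IsLeafᴬ IsLeafᴮ : Fin N → Set
    IsLeafᴬ v = 3 ℕ.≤ toℕ v × toℕ v ℕ.< 3 ℕ.+ a
    IsLeafᴮ v = 3 ℕ.+ a ℕ.≤ toℕ v × toℕ v ℕ.< 3 ℕ.+ a ℕ.+ b

    centreᴬ~leaf : ∀ {v} → IsLeafᴬ v → Adj centreᴬV v
    centreᴬ~leaf {v} (3≤v , v<a+3) = edge toℕ-centreᴬV refl (e1 (toℕ v) 3≤v v<a+3)
    leaf~centreᴬ : ∀ {v} → IsLeafᴬ v → Adj v centreᴬV
    leaf~centreᴬ {v} (3≤v , v<a+3) = edge⁻¹ refl toℕ-centreᴬV (e1 (toℕ v) 3≤v v<a+3)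
    centreᴮ~leaf : ∀ {v} → IsLeafᴮ v → Adj centreᴮV v
    centreᴮ~leaf {v} (a+3≤v , v<N) = edge toℕ-centreᴮV refl (e2 (toℕ v) a+3≤v v<N)
    leaf~centreᴮ : ∀ {v} → IsLeafᴮ v → Adj v centreᴮV
    leaf~centreᴮ {v} (a+3≤v , v<N) = edge⁻¹ refl toℕ-centreᴮV (e2 (toℕ v) a+3≤v v<N)

  data Position (u : Fin N) : Set where
    at-hub     : u ≡ hubV → Position u
    at-centreᴬ : u ≡ centreᴬV → Position u
    at-centreᴮ : u ≡ centreᴮV → Position u
    at-leafᴬ   : IsLeafᴬ u → Position u
    at-leafᴮ   : IsLeafᴮ u → Position u

  position : ∀ u → Position u
  position u = classify (toℕ u) refl (toℕ<n u)
    where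
    classify : ∀ r → toℕ u ≡ r → r ℕ.< N → Position u
    classify 0 eq _ = at-hub (toℕ-injective (trans eq (sym toℕ-hubV)))
    classify 1 eq _ = at-centreᴬ (toℕ-injective (trans eq (sym toℕ-centreᴬV)))
    classify 2 eq _ = at-centreᴮ (toℕ-injective (trans eq (sym toℕ-centreᴮV)))
    classify r@(suc (suc (suc _))) eq r<N with r ℕ.<? 3 ℕ.+ a
    ... | yes r<a+3 = at-leafᴬ (subst (λ r → 3 ℕ.≤ r × r ℕ.< 3 ℕ.+ a) (sym eq) (s≤s (s≤s (s≤s z≤n)) , r<a+3))
    ... | no  r≮a+3 = at-leafᴮ (subst (λ r → 3 ℕ.+ a ℕ.≤ r × r ℕ.< 3 ℕ.+ a ℕ.+ b) (sym eq)
                                      (ℕ.≮⇒≥ r≮a+3 , subst (r ℕ.<_) (ℕ.+-comm (a ℕ.+ b) 3) r<N))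

  positionClass : ∀ {u} → Position u → VertexClass
  positionClass (at-hub _)     = hub
  positionClass (at-centreᴬ _) = centreᴬ
  positionClass (at-centreᴮ _) = centreᴮ
  positionClass (at-leafᴬ _)   = leafᴬ
  positionClass (at-leafᴮ _)   = leafᴮ

  positionClass-correct : ∀ {u} (p : Position u) → vertexClass a (toℕ u) ≡ positionClass p
  positionClass-correct (at-hub refl)         = cong (vertexClass a) toℕ-hubV
  positionClass-correct (at-centreᴬ refl)     = cong (vertexClass a) toℕ-centreᴬV
  positionClass-correct (at-centreᴮ refl)     = cong (vertexClass a) toℕ-centreᴮV
  positionClass-correct (at-leafᴬ (3≤u , u<a+3)) = vertexClass-leafᴬ a _ 3≤u u<a+3
  positionClass-correct (at-leafᴮ (a+3≤u , _))   = vertexClass-leafᴮ a _ a+3≤u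

  walk-between : ∀ {u v} → u ≢ v → (p : Position u) (q : Position v) →
                 Walk Adj u v (classDist (positionClass p) (positionClass q))
  walk-between u≢v (at-hub refl)     (at-hub refl)     = ⊥-elim (u≢v refl)
  walk-between _   (at-hub refl)     (at-centreᴬ refl) = step hub~centreᴬ here
  walk-between _   (at-hub refl)     (at-centreᴮ refl) = step hub~centreᴮ here
  walk-between _   (at-hub refl)     (at-leafᴬ v)      = step hub~centreᴬ (step (centreᴬ~leaf v) here)
  walk-between _   (at-hub refl)     (at-leafᴮ v)      = step hub~centreᴮ (step (centreᴮ~leaf v) here)
  walk-between _   (at-centreᴬ refl) (at-hub refl)     = step centreᴬ~hub here
  walk-between u≢v (at-centreᴬ refl) (at-centreᴬ refl) = ⊥-elim (u≢v refl)
  walk-between _   (at-centreᴬ refl) (at-centreᴮ refl) = step centreᴬ~hub (step hub~centreᴮ here)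
  walk-between _   (at-centreᴬ refl) (at-leafᴬ v)      = step (centreᴬ~leaf v) here
  walk-between _   (at-centreᴬ refl) (at-leafᴮ v)      =
    step centreᴬ~hub (step hub~centreᴮ (step (centreᴮ~leaf v) here))
  walk-between _   (at-centreᴮ refl) (at-hub refl)     = step centreᴮ~hub here
  walk-between _   (at-centreᴮ refl) (at-centreᴬ refl) = step centreᴮ~hub (step hub~centreᴬ here)
  walk-between u≢v (at-centreᴮ refl) (at-centreᴮ refl) = ⊥-elim (u≢v refl)
  walk-between _   (at-centreᴮ refl) (at-leafᴬ v)      =
    step centreᴮ~hub (step hub~centreᴬ (step (centreᴬ~leaf v) here))
  walk-between _   (at-centreᴮ refl) (at-leafᴮ v)      = step (centreᴮ~leaf v) here
  walk-between _   (at-leafᴬ u)      (at-hub refl)     = step (leaf~centreᴬ u) (step centreᴬ~hub here)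
  walk-between _   (at-leafᴬ u)      (at-centreᴬ refl) = step (leaf~centreᴬ u) here
  walk-between _   (at-leafᴬ u)      (at-centreᴮ refl) =
    step (leaf~centreᴬ u) (step centreᴬ~hub (step hub~centreᴮ here))
  walk-between _   (at-leafᴬ u)      (at-leafᴬ v)      = step (leaf~centreᴬ u) (step (centreᴬ~leaf v) here)
  walk-between _   (at-leafᴬ u)      (at-leafᴮ v)      =
    step (leaf~centreᴬ u) (step centreᴬ~hub (step hub~centreᴮ (step (centreᴮ~leaf v) here)))
  walk-between _   (at-leafᴮ u)      (at-hub refl)     = step (leaf~centreᴮ u) (step centreᴮ~hub here)
  walk-between _   (at-leafᴮ u)      (at-centreᴬ refl) =
    step (leaf~centreᴮ u) (step centreᴮ~hub (step hub~centreᴬ here))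
  walk-between _   (at-leafᴮ u)      (at-centreᴮ refl) = step (leaf~centreᴮ u) here
  walk-between _   (at-leafᴮ u)      (at-leafᴬ v)      =
    step (leaf~centreᴮ u) (step centreᴮ~hub (step hub~centreᴬ (step (centreᴬ~leaf v) here)))
  walk-between _   (at-leafᴮ u)      (at-leafᴮ v)      = step (leaf~centreᴮ u) (step (centreᴮ~leaf v) here)

  shortest-walk : ∀ u v → Walk Adj u v (vertexDist a (toℕ u) (toℕ v))
  shortest-walk u v with u Fin.≟ v
  ... | yes refl rewrite ≡ᵇ-refl (toℕ u) = here
  ... | no u≢v rewrite ≡ᵇ-≢ (u≢v ∘ toℕ-injective)
                     | positionClass-correct (position u) | positionClass-correct (position v) =
    walk-between u≢v (position u) (position v)

  distanceMatrix-entries : ∀ D → IsDistanceMatrix Adj D → ∀ i j → D i j ≡ vertexDist a (toℕ i) (toℕ j)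
  distanceMatrix-entries D isDist i j =
    ℕ.≤-antisym (proj₂ (isDist i j) _ (shortest-walk i j)) (walk-length-≥ (proj₁ (isDist i j)))

shiftedDist-entries : ∀ a b (D : Fin (a ℕ.+ b ℕ.+ 3) → Fin (a ℕ.+ b ℕ.+ 3) → ℕ) → IsDistanceMatrix (TAdj a b) D →
                      ∀ x i j → shiftedDist D x i j ≡ Tmatrix a x (toℕ i) (toℕ j)
shiftedDist-entries a b D isDist x i j rewrite distanceMatrix-entries a b D isDist i j with i Fin.≟ j
... | yes refl rewrite ≡ᵇ-refl (toℕ i) = diagonal x
  where
  diagonal : ∀ x → + 0 - x * + 1 ≡ - x
  diagonal = solve-∀
... | no i≢j rewrite ≡ᵇ-≢ (i≢j ∘ toℕ-injective) = off-diagonal x _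
  where
  off-diagonal : ∀ x d → d - x * + 0 ≡ d
  off-diagonal = solve-∀

^-+-* : ∀ w e f g c → w ^ (e ℕ.+ (f ℕ.+ g)) * c ≡ w ^ e * (w ^ f * w ^ g * c)
^-+-* w e f g c rewrite ℤ.^-distribˡ-+-* w e (f ℕ.+ g) | ℤ.^-distribˡ-+-* w f g =
  regroup (w ^ e) (w ^ f) (w ^ g) c
  where
  regroup : ∀ u v t c → u * (v * t) * c ≡ u * (v * t * c)
  regroup = solve-∀

mainTheorem6 : (a b : ℕ) (D : Fin (a ℕ.+ b ℕ.+ 3) → Fin (a ℕ.+ b ℕ.+ 3) → ℕ) →
    IsDistanceMatrix (TAdj a b) D → (x : ℤ) →
    ((- x - + 2) ^ (2 ∸ (a ℕ.+ b))) * det (shiftedDist D x)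
      ≡ ((- x - + 2) ^ ((a ℕ.+ b) ∸ 2)) * p a b x
mainTheorem6 a b D isDist x = begin
  w ^ (2 ∸ n) * det (shiftedDist D x)
    ≡⟨ cong (w ^ (2 ∸ n) *_) (det-cong (shiftedDist-entries a b D isDist x)) ⟩
  w ^ (2 ∸ n) * Δ a b x
    ≡⟨ cong (w ^ (2 ∸ n) *_) (Δ-factorisation a b x) ⟩
  w ^ (2 ∸ n) * (w ^ (a ∸ 1) * w ^ (b ∸ 1) * corePoly a b x)
    ≡⟨ ^-+-* w (2 ∸ n) (a ∸ 1) (b ∸ 1) (corePoly a b x) ⟨
  w ^ ((2 ∸ n) ℕ.+ ((a ∸ 1) ℕ.+ (b ∸ 1))) * corePoly a b x
    ≡⟨ cong (λ e → w ^ e * corePoly a b x) (exponent-balance a b) ⟩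
  w ^ ((n ∸ 2) ℕ.+ ((1 ∸ a) ℕ.+ (1 ∸ b))) * corePoly a b x
    ≡⟨ ^-+-* w (n ∸ 2) (1 ∸ a) (1 ∸ b) (corePoly a b x) ⟩
  w ^ (n ∸ 2) * (w ^ (1 ∸ a) * w ^ (1 ∸ b) * corePoly a b x)
    ≡⟨ cong (w ^ (n ∸ 2) *_) (p-factorisation a b x) ⟨
  w ^ (n ∸ 2) * p a b x ∎
  where
  open ≡-Reasoning
  w : ℤ
  w = ζ x
  n : ℕ
  n = a ℕ.+ b
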